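{- For every integer $k \geq 2$ and every nonzero complex number $z$, the following identity of formal power series in $q$ holds: \[ \sum_{n = 1}^\infty \left(\sum_{\substack{\pi \in \mathcal{D} (n) \\ \#(\pi) \geq k}} (-1)^{\# (\pi)} \left(1 + z + z^2 + \cdots + z^{s_k (\pi) - s_{k - 1} (\pi) - 1}\right)\right) q^n = (-1)^{k - 1} \frac{q^{(k - 1)(k - 2)/2}}{z} \sum_{m = k - 1}^\infty \left(\frac{q}{z}\right)^m \begin{bmatrix} m-1 \\ k-2\end{bmatrix}_q \sum_{n = m + 1}^\infty z^n \big((q^n; q)_\infty - 1\big). \]
   Context: For a positive integer $n$, $\mathcal{D}(n)$ denotes the set of partitions of $n$ into distinct parts; for $\pi \in \mathcal{D}(n)$, $\#(\pi)$ is the number of parts of $\pi$ and $s_j(\pi)$ is the $j$th smallest part of $\pi$ (for $j\ge1$). Here $(a;q)_\infty=\prod_{i\ge0}(1-aq^i)$, $(q;q)_n=(1-q)\cdots(1-q^n)$, and $\begin{bmatrix} n \\ r\end{bmatrix}_q = \frac{(q;q)_n}{(q;q)_r (q;q)_{n-r}}$ for $n\ge r\ge 0$ and $0$ for $n<r$. -}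

module Defs where

open import Level using (Level)
open import Algebra.Bundles using (CommutativeRing)
open import Data.Bool using (Bool; true; false; if_then_else_)
open import Data.Nat using (ℕ; zero; suc; _∸_; _/_; _≤ᵇ_; _≤?_; _≟_)
import Data.Nat as ℕ
open import Data.Nat.ListAction using (sum)
open import Data.List using (List; []; _∷_; map; foldr; upTo; filter; length; _++_; zipWith)
open import Relation.Nullary using (does)

sublists : List ℕ → List (List ℕ)
sublists []       = [] ∷ []
sublists (x ∷ xs) = map (x ∷_) (sublists xs) ++ sublists xs

-- 𝒟(n): partitions of n into distinct parts, each represented as the
-- strictly increasing list of its parts (= subsets of {1,…,n} with sum n)
D : ℕ → List (List ℕ)
D n = filter (λ π → sum π ≟ n) (sublists (map suc (upTo n)))

-- s_j(π): j-th smallest part (1-indexed); default 0 if out of range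
s : ℕ → List ℕ → ℕ
s _             []       = 0
s zero          (_ ∷ _)  = 0
s (suc zero)    (x ∷ _)  = x
s (suc (suc j)) (_ ∷ xs) = s (suc j) xs

range : ℕ → ℕ → List ℕ
range a b = map (a ℕ.+_) (upTo (suc b ∸ a))

module _ {c ℓ : Level} (R : CommutativeRing c ℓ) where
  open CommutativeRing R

  Series : Set c
  Series = ℕ → Carrier

  pow : Carrier → ℕ → Carrier
  pow x zero    = 1#
  pow x (suc n) = x * pow x n

  sumR : List Carrier → Carrier
  sumR = foldr _+_ 0#

  sign : ℕ → Carrier
  sign n = pow (- 1#) n

  geom : Carrier → ℕ → Carrier
  geom x d = sumR (map (pow x) (upTo d))

  qmon : ℕ → Series
  qmon m N = if does (N ≟ m) then 1# else 0#

  oneS : Series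
  oneS = qmon 0

  _⊕_ _⊖_ : Series → Series → Series
  (f ⊕ g) N = f N + g N
  (f ⊖ g) N = f N - g N

  scale : Carrier → Series → Series
  scale a f N = a * f N

  _⊛_ : Series → Series → Series
  (f ⊛ g) N = sumR (map (λ i → f i * g (N ∸ i)) (upTo (suc N)))

  prodS : List Series → Series
  prodS = foldr _⊛_ oneS

  pochFin : ℕ → ℕ → Series
  pochFin a n = prodS (map (λ i → oneS ⊖ qmon (a ℕ.+ i)) (upTo n))

  -- (q^a; q)_∞ : its coefficient of q^N is that of the finite product
  -- ∏_{i ≤ N} (1 - q^(a+i)) (the remaining factors are ≡ 1 mod q^(N+1))
  pochInf : ℕ → Series
  pochInf a N = pochFin a (suc N) N

  qfac : ℕ → Series
  qfac n = pochFin 1 n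

  -- multiplicative inverse of a series with constant term 1:
  -- invList f N = [c_N, …, c_1, c_0] with c_0 = 1,
  -- c_M = - Σ_{i=1}^{M} f_i c_{M-i}
  invList : Series → ℕ → List Carrier
  invList f zero    = 1# ∷ []
  invList f (suc N) =
    let prev = invList f N
    in (- sumR (zipWith _*_ (map (λ i → f (suc i)) (upTo (suc N))) prev)) ∷ prev

  invS : Series → Series
  invS f N with invList f N
  ... | []    = 0#
  ... | x ∷ _ = x

  qbinom : ℕ → ℕ → Series
  qbinom n r N =
    if r ≤ᵇ n then (qfac n ⊛ invS (qfac r ⊛ qfac (n ∸ r))) N else 0#

  -- Σ_{n ≥ a} F n, for families where F n has q-order ≥ n
  -- (so coefficient N only receives contributions from n ≤ N)
  sumFrom : ℕ → (ℕ → Series) → Series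
  sumFrom a F N = sumR (map (λ n → F n N) (range a N))

  -- The two sides of Theorem 4.1, as series in q (z a unit, w = z⁻¹)

  lhsTerm : ℕ → Carrier → List ℕ → Carrier
  lhsTerm k z π = sign (length π) * geom z (s k π ∸ s (k ∸ 1) π)

  lhs : ℕ → Carrier → Series
  lhs k z zero    = 0#
  lhs k z (suc n) =
    sumR (map (lhsTerm k z) (filter (λ π → k ≤? length π) (D (suc n))))

  inner : Carrier → ℕ → Series
  inner z m = sumFrom (suc m) (λ n → scale (pow z n) (pochInf n ⊖ oneS))

  rhs : ℕ → Carrier → Carrier → Series
  rhs k z w =
    scale (sign (k ∸ 1) * w)
      (qmon (((k ∸ 1) ℕ.* (k ∸ 2)) / 2) ⊛
        sumFrom (k ∸ 1)
          (λ m → scale (pow w m)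
                   (qmon m ⊛ (qbinom (m ∸ 1) (k ∸ 2) ⊛ inner z m))))

module Submission where

-- Both sides are compared coefficientwise, as power series over any commutative ring in which z
-- has an inverse w. For a list L of admissible parts let Φ_k(L) be the left-hand side with parts
-- in L, e_r(L) the r-th elementary symmetric function of the q^x (x ∈ L), and Θ_m(L) the signed
-- generating function of sets of parts above m, weighted by 1 + z + ⋯ + z^{(smallest part) - m - 1}.
-- Cutting a partition at its (k-1)-st smallest part m gives
--   Φ_k(L) = Σ_{L = L₁ ++ m ∷ L₂} (-1)^{k-1} q^m e_{k-2}(L₁) Θ_m(L₂).
-- For L = [1, …, N] this matches the right-hand side term by term: the q-Pascal recursion gives
-- e_{k-2}(q, …, q^{m-1}) = q^{(k-1)(k-2)/2} [m-1, k-2]_q, and both Θ_m([m+1, …, N]) and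
-- z^{-m-1} Σ_{n>m} z^n ((q^n;q)_∞ - 1) satisfy X_m = (∏_{x>m} (1 - q^x) - 1) + z X_{m+1},
-- so they agree up to q^N.

open import Level using (Level)
open import Algebra.Bundles using (CommutativeRing)
open import Data.Bool using (true; false; if_then_else_)
open import Data.Bool.Properties using (T-≡)
open import Data.Empty using (⊥-elim)
open import Data.Nat as ℕ using (ℕ; zero; suc; _∸_; _≤_; _<_; z≤n; s≤s; _≡ᵇ_; _≤?_)
import Data.Nat.Properties as ℕP
open import Data.List using (List; []; _∷_; map; upTo; applyUpTo; _++_; filter; zipWith; length)
import Data.List.Properties as List
import Algebra.Properties.Ring
import Data.Nat.DivMod
import Data.Nat.Tactic.RingSolver
open import Data.Product using (_,_)
open import Data.Sum using (inj₁; inj₂)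
open import Data.List.Relation.Unary.All as All using (All; []; _∷_)
open import Data.Nat.ListAction using (sum)
open import Function using (_∘_; id; Equivalence)
open import Relation.Binary.PropositionalEquality as P using (_≡_)
open import Relation.Nullary using (does; yes; no; ofʸ)
open import Relation.Unary using (Pred; Decidable)
open import Defs using (Series; sumR; qmon; scale; pow; sign; geom; sublists; D; range; lhs; lhsTerm; rhs)

interval : ℕ → ℕ → List ℕ
interval a zero    = []
interval a (suc n) = a ∷ interval (suc a) n

length-interval : ∀ a n → length (interval a n) ≡ n
length-interval a zero    = P.refl
length-interval a (suc n) = P.cong suc (length-interval (suc a) n)

All-interval : ∀ a n → All (a ≤_) (interval a n)
All-interval a zero    = []
All-interval a (suc n) = ℕP.≤-refl ∷ All.map (ℕP.≤-trans (ℕP.n≤1+n a)) (All-interval (suc a) n)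

map-upTo≡interval : ∀ a n → map (a ℕ.+_) (upTo n) ≡ interval a n
map-upTo≡interval a zero    = P.refl
map-upTo≡interval a (suc n) = P.cong₂ _∷_ (ℕP.+-identityʳ a) (begin
  map (a ℕ.+_) (applyUpTo suc n)   ≡⟨ P.cong (map (a ℕ.+_)) (List.map-upTo suc n) ⟨
  map (a ℕ.+_) (map suc (upTo n))  ≡⟨ List.map-∘ (upTo n) ⟨
  map (λ i → a ℕ.+ suc i) (upTo n) ≡⟨ List.map-cong (ℕP.+-suc a) (upTo n) ⟩
  map (suc a ℕ.+_) (upTo n)        ≡⟨ map-upTo≡interval (suc a) n ⟩
  interval (suc a) n               ∎)
  where open P.≡-Reasoning

range≡interval : ∀ a b → range a b ≡ interval a (suc b ∸ a)
range≡interval a b = map-upTo≡interval a (suc b ∸ a)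

module FiniteSum {c ℓ : Level} (R : CommutativeRing c ℓ) where
  open CommutativeRing R
  open import Relation.Binary.Reasoning.Setoid setoid
  open import Algebra.Properties.CommutativeSemigroup +-commutativeSemigroup using (interchange)

  opaque
    ∑ : ℕ → (ℕ → Carrier) → Carrier
    ∑ zero    f = 0#
    ∑ (suc n) f = f 0 + ∑ n (f ∘ suc)

    ∑-empty : ∀ f → ∑ 0 f ≡ 0#
    ∑-empty f = P.refl

    ∑-suc : ∀ n f → ∑ (suc n) f ≡ f 0 + ∑ n (f ∘ suc)
    ∑-suc n f = P.refl

    sumR-applyUpTo : ∀ n f → sumR R (applyUpTo f n) ≡ ∑ n f
    sumR-applyUpTo zero    f = P.refl
    sumR-applyUpTo (suc n) f = P.cong (f 0 +_) (sumR-applyUpTo n (f ∘ suc))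

    sumR-map-upTo : ∀ n f → sumR R (map f (upTo n)) ≡ ∑ n f
    sumR-map-upTo n f = P.trans (P.cong (sumR R) (List.map-applyUpTo id f n)) (sumR-applyUpTo n f)

    ∑-cong< : ∀ n {f g} → (∀ i → i < n → f i ≈ g i) → ∑ n f ≈ ∑ n g
    ∑-cong< zero    f≈g = refl
    ∑-cong< (suc n) f≈g = +-cong (f≈g 0 (s≤s z≤n)) (∑-cong< n (λ i i<n → f≈g (suc i) (s≤s i<n)))

    ∑-cong : ∀ n {f g} → (∀ i → f i ≈ g i) → ∑ n f ≈ ∑ n g
    ∑-cong n f≈g = ∑-cong< n (λ i _ → f≈g i)

    ∑-zero : ∀ n {f} → (∀ i → i < n → f i ≈ 0#) → ∑ n f ≈ 0#
    ∑-zero zero    f≈0 = refl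
    ∑-zero (suc n) f≈0 =
      trans (+-cong (f≈0 0 (s≤s z≤n)) (∑-zero n (λ i i<n → f≈0 (suc i) (s≤s i<n)))) (+-identityˡ 0#)

    ∑-+ : ∀ n f g → ∑ n (λ i → f i + g i) ≈ ∑ n f + ∑ n g
    ∑-+ zero    f g = sym (+-identityˡ 0#)
    ∑-+ (suc n) f g = trans (+-congˡ (∑-+ n (f ∘ suc) (g ∘ suc))) (interchange _ _ _ _)

    ∑-*ˡ : ∀ n a f → a * ∑ n f ≈ ∑ n (λ i → a * f i)
    ∑-*ˡ zero    a f = zeroʳ a
    ∑-*ˡ (suc n) a f = trans (distribˡ a _ _) (+-congˡ (∑-*ˡ n a (f ∘ suc)))

    ∑-*ʳ : ∀ n a f → ∑ n f * a ≈ ∑ n (λ i → f i * a)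
    ∑-*ʳ n a f = trans (*-comm _ a) (trans (∑-*ˡ n a f) (∑-cong n (λ i → *-comm a (f i))))

    ∑-snoc : ∀ n f → ∑ (suc n) f ≈ ∑ n f + f n
    ∑-snoc zero    f = trans (+-identityʳ _) (sym (+-identityˡ _))
    ∑-snoc (suc n) f = trans (+-congˡ (∑-snoc n (f ∘ suc))) (sym (+-assoc _ _ _))

    ∑-pad : ∀ n d f → (∀ i → n ≤ i → f i ≈ 0#) → ∑ (n ℕ.+ d) f ≈ ∑ n f
    ∑-pad n zero    f f≈0 = reflexive (P.cong (λ m → ∑ m f) (ℕP.+-identityʳ n))
    ∑-pad n (suc d) f f≈0 = begin
      ∑ (n ℕ.+ suc d) f       ≡⟨ P.cong (λ m → ∑ m f) (ℕP.+-suc n d) ⟩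
      ∑ (suc (n ℕ.+ d)) f     ≈⟨ ∑-snoc (n ℕ.+ d) f ⟩
      ∑ (n ℕ.+ d) f + f (n ℕ.+ d) ≈⟨ +-cong (∑-pad n d f f≈0) (f≈0 _ (ℕP.m≤m+n n d)) ⟩
      ∑ n f + 0#              ≈⟨ +-identityʳ _ ⟩
      ∑ n f                   ∎

    ∑-reverse : ∀ n f → ∑ n f ≈ ∑ n (λ i → f (n ∸ suc i))
    ∑-reverse zero    f = refl
    ∑-reverse (suc n) f = begin
      f 0 + ∑ n (f ∘ suc)                          ≈⟨ +-congˡ (∑-reverse n (f ∘ suc)) ⟩
      f 0 + ∑ n (λ i → f (suc (n ∸ suc i)))        ≈⟨ +-comm _ _ ⟩
      ∑ n (λ i → f (suc (n ∸ suc i))) + f 0        ≈⟨ +-cong (∑-cong< n (λ i i<n → reflexive (P.cong f (P.sym (ℕP.+-∸-assoc 1 i<n)))))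
                                                             (reflexive (P.cong f (P.sym (ℕP.n∸n≡0 n)))) ⟩
      ∑ n (λ i → f (suc n ∸ suc i)) + f (n ∸ n)    ≈⟨ ∑-snoc n (λ i → f (suc n ∸ suc i)) ⟨
      ∑ (suc n) (λ i → f (suc n ∸ suc i))          ∎

    ∑-triangle : ∀ N (a : ℕ → ℕ → Carrier) →
                 ∑ (suc N) (λ i → ∑ (suc i) (a i)) ≈ ∑ (suc N) (λ j → ∑ (suc (N ∸ j)) (λ l → a (j ℕ.+ l) j))
    ∑-triangle zero    a = refl
    ∑-triangle (suc N) a = begin
      ∑ (suc (suc N)) (λ i → a i 0 + ∑ i (λ j → a i (suc j)))
        ≈⟨ ∑-+ (suc (suc N)) (λ i → a i 0) (λ i → ∑ i (λ j → a i (suc j))) ⟩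
      ∑ (suc (suc N)) (λ i → a i 0) + (0# + ∑ (suc N) (λ i → ∑ (suc i) (λ j → a (suc i) (suc j))))
        ≈⟨ +-congˡ (+-identityˡ _) ⟩
      ∑ (suc (suc N)) (λ i → a i 0) + ∑ (suc N) (λ i → ∑ (suc i) (λ j → a (suc i) (suc j)))
        ≈⟨ +-congˡ (∑-triangle N (λ i j → a (suc i) (suc j))) ⟩
      ∑ (suc (suc N)) (λ l → a l 0) + ∑ (suc N) (λ j → ∑ (suc (N ∸ j)) (λ l → a (suc j ℕ.+ l) (suc j))) ∎

  sumR-++ : ∀ xs ys → sumR R (xs ++ ys) ≈ sumR R xs + sumR R ys
  sumR-++ []       ys = sym (+-identityˡ _)
  sumR-++ (x ∷ xs) ys = trans (+-congˡ (sumR-++ xs ys)) (sym (+-assoc _ _ _))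

  module _ {A : Set} where

    sumR-map-cong : ∀ {f g : A → Carrier} xs → (∀ x → f x ≈ g x) → sumR R (map f xs) ≈ sumR R (map g xs)
    sumR-map-cong []       f≈g = refl
    sumR-map-cong (x ∷ xs) f≈g = +-cong (f≈g x) (sumR-map-cong xs f≈g)

    sumR-map-*ˡ : ∀ a (f : A → Carrier) xs → sumR R (map (λ x → a * f x) xs) ≈ a * sumR R (map f xs)
    sumR-map-*ˡ a f []       = sym (zeroʳ a)
    sumR-map-*ˡ a f (x ∷ xs) = trans (+-congˡ (sumR-map-*ˡ a f xs)) (sym (distribˡ _ _ _))

    sumR-map-0 : ∀ (xs : List A) → sumR R (map (λ _ → 0#) xs) ≈ 0#
    sumR-map-0 []       = refl
    sumR-map-0 (x ∷ xs) = trans (+-congˡ (sumR-map-0 xs)) (+-identityˡ _)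

    sumR-map-filter : ∀ {p} {Q : Pred A p} (Q? : Decidable Q) (f : A → Carrier) xs →
                      sumR R (map f (filter Q? xs)) ≈ sumR R (map (λ x → if does (Q? x) then f x else 0#) xs)
    sumR-map-filter Q? f []       = refl
    sumR-map-filter Q? f (x ∷ xs) with does (Q? x)
    ... | true  = +-congˡ (sumR-map-filter Q? f xs)
    ... | false = trans (sumR-map-filter Q? f xs) (sym (+-identityˡ _))

  if-cong : ∀ b {x y} → x ≈ y → (if b then x else 0#) ≈ (if b then y else 0#)
  if-cong true  x≈y = x≈y
  if-cong false x≈y = refl

  if-*ˡ : ∀ b a x → (if b then a * x else 0#) ≈ a * (if b then x else 0#)
  if-*ˡ true  a x = refl
  if-*ˡ false a x = sym (zeroʳ a)

module PowerSeries {c ℓ : Level} (R : CommutativeRing c ℓ) where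
  open CommutativeRing R
  open FiniteSum R
  open import Relation.Binary.Reasoning.Setoid setoid

  Ser : Set c
  Ser = Series R

  infixl 7 _⊛_
  infixl 6 _⊕_
  infix 4 _≋_

  _⊕_ _⊛_ : Ser → Ser → Ser
  _⊕_ = Defs._⊕_ R
  _⊛_ = Defs._⊛_ R

  1S : Ser
  1S = Defs.oneS R

  _≋_ : Ser → Ser → Set ℓ
  f ≋ g = ∀ N → f N ≈ g N

  ⊛-∑ : ∀ f g N → (f ⊛ g) N ≡ ∑ (suc N) (λ i → f i * g (N ∸ i))
  ⊛-∑ f g N = sumR-map-upTo (suc N) (λ i → f i * g (N ∸ i))

  ⊛-comm : ∀ f g → f ⊛ g ≋ g ⊛ f
  ⊛-comm f g N = begin
    (f ⊛ g) N                                     ≡⟨ ⊛-∑ f g N ⟩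
    ∑ (suc N) (λ i → f i * g (N ∸ i))             ≈⟨ ∑-reverse (suc N) _ ⟩
    ∑ (suc N) (λ i → f (N ∸ i) * g (N ∸ (N ∸ i))) ≈⟨ ∑-cong< (suc N) swap ⟩
    ∑ (suc N) (λ i → g i * f (N ∸ i))             ≡⟨ ⊛-∑ g f N ⟨
    (g ⊛ f) N                                     ∎
    where
    swap : ∀ i → i < suc N → f (N ∸ i) * g (N ∸ (N ∸ i)) ≈ g i * f (N ∸ i)
    swap i (s≤s i≤N) = trans (*-comm _ _) (*-congʳ (reflexive (P.cong g (ℕP.m∸[m∸n]≡n i≤N))))

  ⊛-assoc : ∀ f g h → (f ⊛ g) ⊛ h ≋ f ⊛ (g ⊛ h)
  ⊛-assoc f g h N = begin
    ((f ⊛ g) ⊛ h) N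
      ≡⟨ ⊛-∑ (f ⊛ g) h N ⟩
    ∑ (suc N) (λ i → (f ⊛ g) i * h (N ∸ i))
      ≈⟨ ∑-cong (suc N) (λ i → trans (*-congʳ (reflexive (⊛-∑ f g i))) (∑-*ʳ (suc i) _ _)) ⟩
    ∑ (suc N) (λ i → ∑ (suc i) (λ j → (f j * g (i ∸ j)) * h (N ∸ i)))
      ≈⟨ ∑-triangle N _ ⟩
    ∑ (suc N) (λ j → ∑ (suc (N ∸ j)) (λ l → (f j * g (j ℕ.+ l ∸ j)) * h (N ∸ (j ℕ.+ l))))
      ≈⟨ ∑-cong (suc N) (λ j → trans (∑-cong (suc (N ∸ j)) (reindex j)) (sym (∑-*ˡ (suc (N ∸ j)) (f j) _))) ⟩
    ∑ (suc N) (λ j → f j * ∑ (suc (N ∸ j)) (λ l → g l * h (N ∸ j ∸ l)))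
      ≈⟨ ∑-cong (suc N) (λ j → *-congˡ (reflexive (P.sym (⊛-∑ g h (N ∸ j))))) ⟩
    ∑ (suc N) (λ j → f j * (g ⊛ h) (N ∸ j))
      ≡⟨ ⊛-∑ f (g ⊛ h) N ⟨
    (f ⊛ (g ⊛ h)) N
      ∎
    where
    reindex : ∀ j l → (f j * g (j ℕ.+ l ∸ j)) * h (N ∸ (j ℕ.+ l)) ≈ f j * (g l * h (N ∸ j ∸ l))
    reindex j l = trans (*-assoc _ _ _)
      (*-congˡ (*-cong (reflexive (P.cong g (ℕP.m+n∸m≡n j l))) (reflexive (P.cong h (P.sym (ℕP.∸-+-assoc N j l))))))

  ⊛-cong : ∀ {f f′ g g′} → f ≋ f′ → g ≋ g′ → f ⊛ g ≋ f′ ⊛ g′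
  ⊛-cong {f} {f′} {g} {g′} f≋f′ g≋g′ N = begin
    (f ⊛ g) N                            ≡⟨ ⊛-∑ f g N ⟩
    ∑ (suc N) (λ i → f i * g (N ∸ i))    ≈⟨ ∑-cong (suc N) (λ i → *-cong (f≋f′ i) (g≋g′ (N ∸ i))) ⟩
    ∑ (suc N) (λ i → f′ i * g′ (N ∸ i))  ≡⟨ ⊛-∑ f′ g′ N ⟨
    (f′ ⊛ g′) N                          ∎

  ⊛-distribˡ : ∀ f g h → f ⊛ (g ⊕ h) ≋ f ⊛ g ⊕ f ⊛ h
  ⊛-distribˡ f g h N = begin
    (f ⊛ (g ⊕ h)) N                                                          ≡⟨ ⊛-∑ f (g ⊕ h) N ⟩
    ∑ (suc N) (λ i → f i * (g (N ∸ i) + h (N ∸ i)))                          ≈⟨ ∑-cong (suc N) (λ i → distribˡ _ _ _) ⟩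
    ∑ (suc N) (λ i → f i * g (N ∸ i) + f i * h (N ∸ i))                      ≈⟨ ∑-+ (suc N) _ _ ⟩
    ∑ (suc N) (λ i → f i * g (N ∸ i)) + ∑ (suc N) (λ i → f i * h (N ∸ i))    ≡⟨ P.cong₂ _+_ (⊛-∑ f g N) (⊛-∑ f h N) ⟨
    (f ⊛ g ⊕ f ⊛ h) N                                                        ∎

  ⊛-identityˡ : ∀ f → 1S ⊛ f ≋ f
  ⊛-identityˡ f N = begin
    (1S ⊛ f) N                                     ≡⟨ P.trans (⊛-∑ 1S f N) (∑-suc N _) ⟩
    1# * f N + ∑ N (λ i → 0# * f (N ∸ suc i))      ≈⟨ +-cong (*-identityˡ _) (∑-zero N (λ i _ → zeroˡ _)) ⟩
    f N + 0#                                       ≈⟨ +-identityʳ _ ⟩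
    f N                                            ∎

  SR : CommutativeRing c ℓ
  SR = record
    { Carrier = Ser ; _≈_ = _≋_ ; _+_ = _⊕_ ; _*_ = _⊛_ ; -_ = λ f N → - f N ; 0# = λ _ → 0# ; 1# = 1S
    ; isCommutativeRing = record
      { isRing = record
        { +-isAbelianGroup = record
          { isGroup = record
            { isMonoid = record
              { isSemigroup = record
                { isMagma = record
                  { isEquivalence = record
                    { refl = λ N → refl ; sym = λ e N → sym (e N) ; trans = λ e e′ N → trans (e N) (e′ N) }
                  ; ∙-cong = λ e e′ N → +-cong (e N) (e′ N) }
                ; assoc = λ f g h N → +-assoc (f N) (g N) (h N) }
              ; identity = (λ f N → +-identityˡ (f N)) , (λ f N → +-identityʳ (f N)) }
            ; inverse = (λ f N → -‿inverseˡ (f N)) , (λ f N → -‿inverseʳ (f N))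
            ; ⁻¹-cong = λ e N → -‿cong (e N) }
          ; comm = λ f g N → +-comm (f N) (g N) }
        ; *-cong = ⊛-cong
        ; *-assoc = ⊛-assoc
        ; *-identity = ⊛-identityˡ , (λ f N → trans (⊛-comm f 1S N) (⊛-identityˡ f N))
        ; distrib = ⊛-distribˡ , (λ f g h N → trans (⊛-comm (g ⊕ h) f N)
                                    (trans (⊛-distribˡ f g h N) (+-cong (⊛-comm f g N) (⊛-comm f h N)))) }
      ; *-comm = ⊛-comm } }

  const : Carrier → Ser
  const a = scale R a 1S

  scale≋const⊛ : ∀ a f → scale R a f ≋ const a ⊛ f
  scale≋const⊛ a f N = sym (begin
    (const a ⊛ f) N                                         ≡⟨ P.trans (⊛-∑ (const a) f N) (∑-suc N _) ⟩
    (a * 1#) * f N + ∑ N (λ i → (a * 0#) * f (N ∸ suc i))   ≈⟨ +-cong (*-congʳ (*-identityʳ a))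
                                                                 (∑-zero N (λ i _ → trans (*-congʳ (zeroʳ a)) (zeroˡ _))) ⟩
    a * f N + 0#                                            ≈⟨ +-identityʳ _ ⟩
    a * f N                                                 ∎)

  const-+ : ∀ a b → const (a + b) ≋ const a ⊕ const b
  const-+ a b N = distribʳ _ a b

  const-* : ∀ a b → const (a * b) ≋ const a ⊛ const b
  const-* a b N = trans (*-assoc a b _) (scale≋const⊛ a (const b) N)

  ⊛-constant-term : ∀ f g → (f ⊛ g) 0 ≈ f 0 * g 0
  ⊛-constant-term f g = trans (reflexive (P.trans (⊛-∑ f g 0) (P.trans (∑-suc 0 _) (P.cong (f 0 * g 0 +_) (∑-empty _))))) (+-identityʳ _)

  shift : ℕ → Ser → Ser
  shift zero    f N       = f N
  shift (suc a) f zero    = 0#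
  shift (suc a) f (suc N) = shift a f N

  qmon⊛≋shift : ∀ a f → qmon R a ⊛ f ≋ shift a f
  qmon⊛≋shift zero    f = ⊛-identityˡ f
  qmon⊛≋shift (suc a) f zero    = trans (⊛-constant-term (qmon R (suc a)) f) (zeroˡ _)
  qmon⊛≋shift (suc a) f (suc N) = begin
    (qmon R (suc a) ⊛ f) (suc N)                                   ≡⟨ P.trans (⊛-∑ _ f (suc N)) (∑-suc (suc N) _) ⟩
    0# * f (suc N) + ∑ (suc N) (λ i → qmon R a i * f (N ∸ i))      ≈⟨ +-cong (zeroˡ _) (reflexive (P.sym (⊛-∑ _ f N))) ⟩
    0# + (qmon R a ⊛ f) N                                          ≈⟨ +-identityˡ _ ⟩
    (qmon R a ⊛ f) N                                               ≈⟨ qmon⊛≋shift a f N ⟩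
    shift a f N                                                    ∎

  qmon-+ : ∀ a b → qmon R a ⊛ qmon R b ≋ qmon R (a ℕ.+ b)
  qmon-+ a b N = trans (qmon⊛≋shift a (qmon R b) N) (shift-qmon a N)
    where
    shift-qmon : ∀ a N → shift a (qmon R b) N ≈ qmon R (a ℕ.+ b) N
    shift-qmon zero    N       = refl
    shift-qmon (suc a) zero    = refl
    shift-qmon (suc a) (suc N) = shift-qmon a N

  qmon⊛-below : ∀ a f N → N < a → (qmon R a ⊛ f) N ≈ 0#
  qmon⊛-below a f N N<a = trans (qmon⊛≋shift a f N) (shift-below a N N<a)
    where
    shift-below : ∀ a N → N < a → shift a f N ≈ 0#
    shift-below (suc a) zero    _         = refl
    shift-below (suc a) (suc N) (s≤s N<a) = shift-below a N N<a

  infix 4 _≈[_]_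
  _≈[_]_ : Ser → ℕ → Ser → Set ℓ
  f ≈[ M ] g = ∀ N → N ≤ M → f N ≈ g N

  ≋⇒≈[] : ∀ {M f g} → f ≋ g → f ≈[ M ] g
  ≋⇒≈[] f≋g N _ = f≋g N

  ≈[]-refl : ∀ {M f} → f ≈[ M ] f
  ≈[]-refl N _ = refl

  ≈[]-sym : ∀ {M f g} → f ≈[ M ] g → g ≈[ M ] f
  ≈[]-sym f≈g N N≤M = sym (f≈g N N≤M)

  ≈[]-trans : ∀ {M f g h} → f ≈[ M ] g → g ≈[ M ] h → f ≈[ M ] h
  ≈[]-trans f≈g g≈h N N≤M = trans (f≈g N N≤M) (g≈h N N≤M)

  ≈[]-weaken : ∀ {M M′ f g} → M′ ≤ M → f ≈[ M ] g → f ≈[ M′ ] g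
  ≈[]-weaken M′≤M f≈g N N≤M′ = f≈g N (ℕP.≤-trans N≤M′ M′≤M)

  ⊕-cong-≈[] : ∀ {M f f′ g g′} → f ≈[ M ] f′ → g ≈[ M ] g′ → f ⊕ g ≈[ M ] f′ ⊕ g′
  ⊕-cong-≈[] f≈f′ g≈g′ N N≤M = +-cong (f≈f′ N N≤M) (g≈g′ N N≤M)

  ⊛-cong-≈[] : ∀ {M f f′ g g′} → f ≈[ M ] f′ → g ≈[ M ] g′ → f ⊛ g ≈[ M ] f′ ⊛ g′
  ⊛-cong-≈[] {M} {f} {f′} {g} {g′} f≈f′ g≈g′ N N≤M = begin
    (f ⊛ g) N                            ≡⟨ ⊛-∑ f g N ⟩
    ∑ (suc N) (λ i → f i * g (N ∸ i))    ≈⟨ ∑-cong< (suc N) factors ⟩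
    ∑ (suc N) (λ i → f′ i * g′ (N ∸ i))  ≡⟨ ⊛-∑ f′ g′ N ⟨
    (f′ ⊛ g′) N                          ∎
    where
    factors : ∀ i → i < suc N → f i * g (N ∸ i) ≈ f′ i * g′ (N ∸ i)
    factors i (s≤s i≤N) = *-cong (f≈f′ i (ℕP.≤-trans i≤N N≤M)) (g≈g′ (N ∸ i) (ℕP.≤-trans (ℕP.m∸n≤m N i) N≤M))

  private
    zipWith-map-diag : ∀ {A : Set} (_∙_ : Carrier → Carrier → Carrier) (f g : A → Carrier) xs →
                       zipWith _∙_ (map f xs) (map g xs) ≡ map (λ x → f x ∙ g x) xs
    zipWith-map-diag _∙_ f g []       = P.refl
    zipWith-map-diag _∙_ f g (x ∷ xs) = P.cong (_ ∷_) (zipWith-map-diag _∙_ f g xs)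

  invList≡ : ∀ f N → Defs.invList R f N ≡ map (λ i → Defs.invS R f (N ∸ i)) (upTo (suc N))
  invList≡ f zero    = P.refl
  invList≡ f (suc N) = P.cong (Defs.invS R f (suc N) ∷_) (P.trans (invList≡ f N)
    (P.trans (List.map-applyUpTo id _ (suc N)) (P.sym (List.map-applyUpTo suc _ (suc N)))))

  invS-suc : ∀ f N → Defs.invS R f (suc N) ≈ - ∑ (suc N) (λ i → f (suc i) * Defs.invS R f (N ∸ i))
  invS-suc f N = -‿cong (reflexive (P.trans
    (P.cong (λ l → sumR R (zipWith _*_ (map (f ∘ suc) (upTo (suc N))) l)) (invList≡ f N))
    (P.trans (P.cong (sumR R) (zipWith-map-diag _*_ (f ∘ suc) _ (upTo (suc N))))
             (sumR-map-upTo (suc N) _))))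

  ⊛-invS : ∀ f → f 0 ≈ 1# → f ⊛ Defs.invS R f ≋ 1S
  ⊛-invS f f₀≈1 zero    = trans (⊛-constant-term f (Defs.invS R f)) (trans (*-identityʳ _) f₀≈1)
  ⊛-invS f f₀≈1 (suc N) = begin
    (f ⊛ Defs.invS R f) (suc N)                ≡⟨ P.trans (⊛-∑ f (Defs.invS R f) (suc N)) (∑-suc (suc N) _) ⟩
    f 0 * Defs.invS R f (suc N) + X            ≈⟨ +-congʳ (*-cong f₀≈1 (invS-suc f N)) ⟩
    1# * - X + X                               ≈⟨ +-congʳ (*-identityˡ _) ⟩
    - X + X                                    ≈⟨ -‿inverseˡ X ⟩
    0#                                         ∎
    where X = ∑ (suc N) (λ i → f (suc i) * Defs.invS R f (N ∸ i))

  sumFrom≡ : ∀ a F N → Defs.sumFrom R a F N ≡ sumR R (map (λ n → F n N) (interval a (suc N ∸ a)))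
  sumFrom≡ a F N = P.cong (λ L → sumR R (map (λ n → F n N) L)) (range≡interval a N)

  sumFrom-vanishes : ∀ a F N → N < a → Defs.sumFrom R a F N ≈ 0#
  sumFrom-vanishes a F N N<a = reflexive (P.trans (sumFrom≡ a F N)
    (P.cong (λ k → sumR R (map (λ n → F n N) (interval a k))) (ℕP.m≤n⇒m∸n≡0 N<a)))

  sumFrom-unfold : ∀ a F N → (N < a → F a N ≈ 0#) → Defs.sumFrom R a F N ≈ F a N + Defs.sumFrom R (suc a) F N
  sumFrom-unfold a F N F-vanishes with a ℕP.≤? N
  ... | yes a≤N = reflexive (P.trans (sumFrom≡ a F N)
    (P.trans (P.cong (λ k → sumR R (map (λ n → F n N) (interval a k))) (ℕP.+-∸-assoc 1 a≤N))
             (P.cong (F a N +_) (P.sym (sumFrom≡ (suc a) F N)))))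
  ... | no a≰N = begin
    Defs.sumFrom R a F N                  ≈⟨ sumFrom-vanishes a F N N<a ⟩
    0#                                    ≈⟨ +-identityʳ 0# ⟨
    0# + 0#                               ≈⟨ +-cong (F-vanishes N<a) (sumFrom-vanishes (suc a) F N (ℕP.m<n⇒m<1+n N<a)) ⟨
    F a N + Defs.sumFrom R (suc a) F N    ∎
    where N<a = ℕP.≰⇒> a≰N

  sumFrom-skip : ∀ a d F → (∀ i → i < d → ∀ N → F (a ℕ.+ i) N ≈ 0#) →
                 ∀ N → Defs.sumFrom R (a ℕ.+ d) F N ≈ Defs.sumFrom R a F N
  sumFrom-skip a zero    F F≈0 N = reflexive (P.cong (λ b → Defs.sumFrom R b F N) (ℕP.+-identityʳ a))
  sumFrom-skip a (suc d) F F≈0 N = begin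
    Defs.sumFrom R (a ℕ.+ suc d) F N                 ≡⟨ P.cong (λ b → Defs.sumFrom R b F N) (ℕP.+-suc a d) ⟩
    Defs.sumFrom R (suc (a ℕ.+ d)) F N               ≈⟨ +-identityˡ _ ⟨
    0# + Defs.sumFrom R (suc (a ℕ.+ d)) F N          ≈⟨ +-congʳ (F≈0 d ℕP.≤-refl N) ⟨
    F (a ℕ.+ d) N + Defs.sumFrom R (suc (a ℕ.+ d)) F N ≈⟨ sumFrom-unfold (a ℕ.+ d) F N (λ _ → F≈0 d ℕP.≤-refl N) ⟨
    Defs.sumFrom R (a ℕ.+ d) F N                     ≈⟨ sumFrom-skip a d F (λ i i<d → F≈0 i (ℕP.m<n⇒m<1+n i<d)) N ⟩
    Defs.sumFrom R a F N                             ∎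

  sumFrom-1 : ∀ F N → Defs.sumFrom R 1 F N ≡ ∑ N (λ t → F (suc t) N)
  sumFrom-1 F N = P.trans (P.cong (sumR R) (P.sym (List.map-∘ (upTo N)))) (sumR-map-upTo N _)

  ∑S : ℕ → (ℕ → Ser) → Ser
  ∑S n F N = ∑ n (λ i → F i N)

  ⊛-∑S : ∀ n f F → f ⊛ ∑S n F ≋ ∑S n (λ i → f ⊛ F i)
  ⊛-∑S zero    f F N = begin
    (f ⊛ ∑S 0 F) N                         ≡⟨ ⊛-∑ f (∑S 0 F) N ⟩
    ∑ (suc N) (λ i → f i * ∑S 0 F (N ∸ i)) ≈⟨ ∑-zero (suc N) (λ i _ → trans (*-congˡ (reflexive (∑-empty _))) (zeroʳ _)) ⟩
    0#                                     ≡⟨ ∑-empty _ ⟨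
    ∑S 0 (λ i → f ⊛ F i) N                 ∎
  ⊛-∑S (suc n) f F N = begin
    (f ⊛ ∑S (suc n) F) N                            ≈⟨ ⊛-cong {f} (λ _ → refl) (λ M → reflexive (∑-suc n (λ i → F i M))) N ⟩
    (f ⊛ (F 0 ⊕ ∑S n (F ∘ suc))) N                  ≈⟨ ⊛-distribˡ f (F 0) (∑S n (F ∘ suc)) N ⟩
    (f ⊛ F 0) N + (f ⊛ ∑S n (F ∘ suc)) N            ≈⟨ +-congˡ (⊛-∑S n f (F ∘ suc) N) ⟩
    (f ⊛ F 0) N + ∑ n (λ i → (f ⊛ F (suc i)) N)     ≡⟨ ∑-suc n (λ i → (f ⊛ F i) N) ⟨
    ∑S (suc n) (λ i → f ⊛ F i) N                    ∎

  sumFrom-1≈[]∑S : ∀ F → (∀ n N → N < n → F n N ≈ 0#) → ∀ M → Defs.sumFrom R 1 F ≈[ M ] ∑S M (F ∘ suc)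
  sumFrom-1≈[]∑S F F≈0 M N N≤M = begin
    Defs.sumFrom R 1 F N                   ≡⟨ sumFrom-1 F N ⟩
    ∑ N (λ t → F (suc t) N)                ≈⟨ ∑-pad N (M ∸ N) _ (λ t N≤t → F≈0 (suc t) N (s≤s N≤t)) ⟨
    ∑ (N ℕ.+ (M ∸ N)) (λ t → F (suc t) N)  ≡⟨ P.cong (λ n → ∑ n (λ t → F (suc t) N)) (ℕP.m+[n∸m]≡n N≤M) ⟩
    ∑S M (F ∘ suc) N                       ∎

module SubsetSums {c ℓ : Level} (R : CommutativeRing c ℓ) where
  open CommutativeRing R
  open FiniteSum R
  open PowerSeries R
  open import Relation.Binary.Reasoning.Setoid setoid

  opaque
    subsetSum : List ℕ → (List ℕ → Carrier) → Ser
    subsetSum L g N = sumR R (map (λ S → if sum S ≡ᵇ N then g S else 0#) (sublists L))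

    subsetSum-def : ∀ L g N → subsetSum L g N ≡ sumR R (map (λ S → if sum S ≡ᵇ N then g S else 0#) (sublists L))
    subsetSum-def L g N = P.refl

    subsetSum-[] : ∀ g → subsetSum [] g ≋ const (g [])
    subsetSum-[] g zero    = trans (+-identityʳ _) (sym (*-identityʳ _))
    subsetSum-[] g (suc N) = trans (+-identityʳ _) (sym (zeroʳ _))

    subsetSum-∷ : ∀ x L g → subsetSum (x ∷ L) g ≋ qmon R x ⊛ subsetSum L (g ∘ (x ∷_)) ⊕ subsetSum L g
    subsetSum-∷ x L g N = begin
      subsetSum (x ∷ L) g N
        ≡⟨ P.cong (sumR R) (List.map-++ term (map (x ∷_) (sublists L)) (sublists L)) ⟩
      sumR R (map term (map (x ∷_) (sublists L)) ++ map term (sublists L))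
        ≈⟨ sumR-++ (map term (map (x ∷_) (sublists L))) _ ⟩
      sumR R (map term (map (x ∷_) (sublists L))) + subsetSum L g N
        ≡⟨ P.cong (λ t → sumR R t + subsetSum L g N) (List.map-∘ (sublists L)) ⟨
      sumR R (map (term ∘ (x ∷_)) (sublists L)) + subsetSum L g N
        ≈⟨ +-congʳ (shifted x N (g ∘ (x ∷_))) ⟩
      shift x (subsetSum L (g ∘ (x ∷_))) N + subsetSum L g N
        ≈⟨ +-congʳ (qmon⊛≋shift x _ N) ⟨
      (qmon R x ⊛ subsetSum L (g ∘ (x ∷_)) ⊕ subsetSum L g) N
        ∎
      where
      term : List ℕ → Carrier
      term S = if sum S ≡ᵇ N then g S else 0#
      shifted : ∀ x N h → sumR R (map (λ S → if x ℕ.+ sum S ≡ᵇ N then h S else 0#) (sublists L))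
                          ≈ shift x (subsetSum L h) N
      shifted zero    N       h = refl
      shifted (suc x) zero    h = sumR-map-0 (sublists L)
      shifted (suc x) (suc N) h = shifted x N h

    subsetSum-cong : ∀ L {g h} → (∀ S → g S ≈ h S) → subsetSum L g ≋ subsetSum L h
    subsetSum-cong L g≈h N = sumR-map-cong (sublists L) (λ S → if-cong (sum S ≡ᵇ N) (g≈h S))

    subsetSum-*ˡ : ∀ L a g → subsetSum L (λ S → a * g S) ≋ const a ⊛ subsetSum L g
    subsetSum-*ˡ L a g N = begin
      subsetSum L (λ S → a * g S) N  ≈⟨ sumR-map-cong (sublists L) (λ S → if-*ˡ (sum S ≡ᵇ N) a (g S)) ⟩
      _                              ≈⟨ sumR-map-*ˡ a _ (sublists L) ⟩
      a * subsetSum L g N            ≈⟨ scale≋const⊛ a (subsetSum L g) N ⟩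
      (const a ⊛ subsetSum L g) N    ∎

    subsetSum-0 : ∀ L → subsetSum L (λ _ → 0#) ≋ λ _ → 0#
    subsetSum-0 L N = trans (sumR-map-cong (sublists L) (λ S → if-0 (sum S ≡ᵇ N))) (sumR-map-0 (sublists L))
      where
      if-0 : ∀ b → (if b then 0# else 0#) ≈ 0#
      if-0 true  = refl
      if-0 false = refl

module SymmetricFunctions {c ℓ : Level} (R : CommutativeRing c ℓ) where
  private module R = CommutativeRing R
  private module RP = Algebra.Properties.Ring R.ring
  open PowerSeries R using (Ser; SR; const; scale≋const⊛)
  open SubsetSums R
  open CommutativeRing SR hiding (zero)
  open import Algebra.Properties.Ring ring using (-‿distribˡ-*; -‿distribʳ-*)
  open import Relation.Binary.Reasoning.Setoid setoid

  q^ : ℕ → Ser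
  q^ = qmon R

  -- e_r of the monomials q^x, x ∈ L
  e : ℕ → List ℕ → Ser
  e r L = subsetSum L (λ S → if length S ≡ᵇ r then R.1# else R.0#)

  -- ∏_{x ∈ L} (1 - q^x)
  Π : List ℕ → Ser
  Π L = subsetSum L (sign R ∘ length)

  sign-suc : ∀ n → sign R (suc n) R.≈ R.- sign R n
  sign-suc n = RP.-1*x≈-x (sign R n)

  subsetSum-neg : ∀ L g → subsetSum L (λ S → R.- g S) ≈ - subsetSum L g
  subsetSum-neg L g N = R.trans (subsetSum-cong L (λ S → R.sym (RP.-1*x≈-x (g S))) N)
    (R.trans (subsetSum-*ˡ L (R.- R.1#) g N) (R.trans (R.sym (scale≋const⊛ (R.- R.1#) (subsetSum L g) N)) (RP.-1*x≈-x _)))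

  subsetSum-∷-alternating : ∀ x L {g} h → (∀ S → g (x ∷ S) R.≈ R.- h S) →
                            subsetSum (x ∷ L) g ≈ - (q^ x * subsetSum L h) + subsetSum L g
  subsetSum-∷-alternating x L {g} h g≈-h = begin
    subsetSum (x ∷ L) g                                ≈⟨ subsetSum-∷ x L g ⟩
    q^ x * subsetSum L (g ∘ (x ∷_)) + subsetSum L g    ≈⟨ +-congʳ (*-congˡ (subsetSum-cong L g≈-h)) ⟩
    q^ x * subsetSum L (λ S → R.- h S) + subsetSum L g ≈⟨ +-congʳ (*-congˡ (subsetSum-neg L h)) ⟩
    q^ x * - subsetSum L h + subsetSum L g             ≈⟨ +-congʳ (-‿distribʳ-* _ _) ⟨
    - (q^ x * subsetSum L h) + subsetSum L g           ∎

  const-1 : const R.1# ≈ 1#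
  const-1 N = R.*-identityˡ _

  const-0 : const R.0# ≈ 0#
  const-0 N = R.zeroˡ _

  const-sign-suc : ∀ n → const (sign R (suc n)) ≈ - const (sign R n)
  const-sign-suc n N = R.trans (R.*-congʳ (sign-suc n)) (R.sym (RP.-‿distribˡ-* _ _))

  e-zero : ∀ L → e 0 L ≈ 1#
  e-zero []      = trans (subsetSum-[] _) const-1
  e-zero (x ∷ L) = begin
    e 0 (x ∷ L)                                 ≈⟨ subsetSum-∷ x L _ ⟩
    q^ x * subsetSum L (λ _ → R.0#) + e 0 L     ≈⟨ +-cong (trans (*-congˡ (subsetSum-0 L)) (zeroʳ _)) (e-zero L) ⟩
    0# + 1#                                     ≈⟨ +-identityˡ 1# ⟩
    1#                                          ∎

  e-suc-[] : ∀ r → e (suc r) [] ≈ 0#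
  e-suc-[] r = trans (subsetSum-[] _) const-0

  e-suc-∷ : ∀ r x L → e (suc r) (x ∷ L) ≈ q^ x * e r L + e (suc r) L
  e-suc-∷ r x L = subsetSum-∷ x L _

  Π-[] : Π [] ≈ 1#
  Π-[] = trans (subsetSum-[] _) const-1

  Π-∷ : ∀ x L → Π (x ∷ L) ≈ - (q^ x * Π L) + Π L
  Π-∷ x L = subsetSum-∷-alternating x L (sign R ∘ length) (λ S → sign-suc (length S))

module Splitting {c ℓ : Level} (R : CommutativeRing c ℓ) (z : CommutativeRing.Carrier R) where
  private module R = CommutativeRing R
  private module RP = Algebra.Properties.Ring R.ring
  open FiniteSum R using (∑; ∑-empty; ∑-suc; ∑-cong; ∑-*ˡ; sumR-map-upTo)
  open PowerSeries R using (Ser; SR; const; const-+; const-*)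
  open SubsetSums R
  open SymmetricFunctions R
  open CommutativeRing SR hiding (zero)
  open import Algebra.Properties.Ring ring using (-‿distribˡ-*; -‿distribʳ-*; -0#≈0#)
  open import Algebra.Properties.CommutativeSemigroup *-commutativeSemigroup using (x∙yz≈y∙xz)
  open import Algebra.Properties.CommutativeSemigroup +-commutativeSemigroup using (interchange)
  open import Algebra.Properties.AbelianGroup +-abelianGroup using (⁻¹-∙-comm)
  open import Relation.Binary.Reasoning.Setoid setoid

  θ-weight : ℕ → List ℕ → R.Carrier
  θ-weight m []      = R.0#
  θ-weight m (y ∷ S) = sign R (length (y ∷ S)) R.* geom R z (y ∸ m)

  -- Σ_{∅ ≠ S ⊆ L} (-1)^{|S|} (1 + z + ⋯ + z^{min S - m - 1}) q^{ΣS}, for increasing L (so min S is its head)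
  Θ : ℕ → List ℕ → Ser
  Θ m L = subsetSum L (θ-weight m)

  Φ : ℕ → List ℕ → Ser
  Φ k L = subsetSum L (λ S → if does (k ≤? length S) then lhsTerm R k z S else R.0#)

  Θ-[] : ∀ m → Θ m [] ≈ 0#
  Θ-[] m = trans (subsetSum-[] _) const-0

  Θ-∷ : ∀ m y L → Θ m (y ∷ L) ≈ - (const (geom R z (y ∸ m)) * (q^ y * Π L)) + Θ m L
  Θ-∷ m y L = begin
    Θ m (y ∷ L)                                            ≈⟨ subsetSum-∷-alternating y L _ θ-weight-∷ ⟩
    - (q^ y * subsetSum L (λ S → g R.* sign R (length S))) + Θ m L
                                                           ≈⟨ +-congʳ (-‿cong (*-congˡ (subsetSum-*ˡ L g _))) ⟩
    - (q^ y * (const g * Π L)) + Θ m L                     ≈⟨ +-congʳ (-‿cong (x∙yz≈y∙xz _ _ _)) ⟩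
    - (const g * (q^ y * Π L)) + Θ m L                     ∎
    where
    g = geom R z (y ∸ m)
    θ-weight-∷ : ∀ S → θ-weight m (y ∷ S) R.≈ R.- (g R.* sign R (length S))
    θ-weight-∷ S = R.trans (R.*-congʳ (sign-suc (length S)))
                     (R.trans (R.sym (RP.-‿distribˡ-* _ _)) (R.-‿cong (R.*-comm _ _)))

  Φ-[] : ∀ j → Φ (suc (suc j)) [] ≈ 0#
  Φ-[] j = trans (subsetSum-[] _) const-0

  Φ-∷ : ∀ j x L → Φ (suc (suc (suc j))) (x ∷ L) ≈ - (q^ x * Φ (suc (suc j)) L) + Φ (suc (suc (suc j))) L
  Φ-∷ j x L = subsetSum-∷-alternating x L _ (λ S → weight (does (suc (suc j) ≤? length S)) (length S))
    where
    weight : ∀ b n {t} → (if b then sign R (suc n) R.* t else R.0#) R.≈ R.- (if b then sign R n R.* t else R.0#)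
    weight true  n = R.trans (R.*-congʳ (sign-suc n)) (R.sym (RP.-‿distribˡ-* _ _))
    weight false n = R.sym RP.-0#≈0#

  Φ₂-∷ : ∀ x L → Φ 2 (x ∷ L) ≈ - (q^ x * Θ x L) + Φ 2 L
  Φ₂-∷ x L = subsetSum-∷-alternating x L (θ-weight x) weight
    where
    weight : ∀ S → (if does (2 ≤? length (x ∷ S)) then lhsTerm R 2 z (x ∷ S) else R.0#) R.≈ R.- θ-weight x S
    weight []      = R.sym RP.-0#≈0#
    weight (y ∷ S) = R.trans (R.*-congʳ (sign-suc (suc (length S)))) (R.sym (RP.-‿distribˡ-* _ _))

  -- Σ over the decompositions L = L₁ ++ m ∷ L₂ of h L₁ m L₂
  ∑splits : (List ℕ → ℕ → List ℕ → Ser) → List ℕ → Ser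
  ∑splits h []      = 0#
  ∑splits h (x ∷ L) = h [] x L + ∑splits (h ∘ (x ∷_)) L

  ∑splits-cong : ∀ L {h h′} → (∀ L₁ m L₂ → h L₁ m L₂ ≈ h′ L₁ m L₂) → ∑splits h L ≈ ∑splits h′ L
  ∑splits-cong []      h≈h′ = refl
  ∑splits-cong (x ∷ L) h≈h′ = +-cong (h≈h′ _ _ _) (∑splits-cong L (λ L₁ → h≈h′ (x ∷ L₁)))

  ∑splits-+ : ∀ L h h′ → ∑splits (λ L₁ m L₂ → h L₁ m L₂ + h′ L₁ m L₂) L ≈ ∑splits h L + ∑splits h′ L
  ∑splits-+ []      h h′ = sym (+-identityˡ _)
  ∑splits-+ (x ∷ L) h h′ = trans (+-congˡ (∑splits-+ L _ _)) (interchange _ _ _ _)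

  ∑splits-*ˡ : ∀ L f h → ∑splits (λ L₁ m L₂ → f * h L₁ m L₂) L ≈ f * ∑splits h L
  ∑splits-*ˡ []      f h = sym (zeroʳ f)
  ∑splits-*ˡ (x ∷ L) f h = trans (+-congˡ (∑splits-*ˡ L f _)) (sym (distribˡ _ _ _))

  ∑splits-neg : ∀ L h → ∑splits (λ L₁ m L₂ → - h L₁ m L₂) L ≈ - ∑splits h L
  ∑splits-neg []      h = sym -0#≈0#
  ∑splits-neg (x ∷ L) h = trans (+-congˡ (∑splits-neg L _)) (⁻¹-∙-comm _ _)

  -- m is the (j+1)-st smallest part, j parts are chosen below it and the rest above it
  splitTerm : ℕ → List ℕ → ℕ → List ℕ → Ser
  splitTerm j L₁ m L₂ = const (sign R (suc j)) * (q^ m * (e j L₁ * Θ m L₂))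

  splitTerm-zero-[] : ∀ x L → splitTerm 0 [] x L ≈ - (q^ x * Θ x L)
  splitTerm-zero-[] x L = begin
    const (sign R 1) * (q^ x * (e 0 [] * Θ x L)) ≈⟨ *-cong (trans (const-sign-suc 0) (-‿cong const-1))
                                                             (*-congˡ (trans (*-congʳ (e-zero [])) (*-identityˡ _))) ⟩
    - 1# * (q^ x * Θ x L)                         ≈⟨ -‿distribˡ-* _ _ ⟨
    - (1# * (q^ x * Θ x L))                       ≈⟨ -‿cong (*-identityˡ _) ⟩
    - (q^ x * Θ x L)                              ∎

  splitTerm-zero-∷ : ∀ x L₁ m L₂ → splitTerm 0 (x ∷ L₁) m L₂ ≈ splitTerm 0 L₁ m L₂
  splitTerm-zero-∷ x L₁ m L₂ = *-congˡ (*-congˡ (*-congʳ (trans (e-zero (x ∷ L₁)) (sym (e-zero L₁)))))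

  splitTerm-suc-[] : ∀ j x L → splitTerm (suc j) [] x L ≈ 0#
  splitTerm-suc-[] j x L = trans (*-congˡ (trans (*-congˡ (trans (*-congʳ (e-suc-[] j)) (zeroˡ _))) (zeroʳ _))) (zeroʳ _)

  splitTerm-suc-∷ : ∀ j x L₁ m L₂ →
                    splitTerm (suc j) (x ∷ L₁) m L₂ ≈ - (q^ x * splitTerm j L₁ m L₂) + splitTerm (suc j) L₁ m L₂
  splitTerm-suc-∷ j x L₁ m L₂ = begin
    const (sign R (2 ℕ.+ j)) * (q^ m * (e (suc j) (x ∷ L₁) * Θ m L₂))
      ≈⟨ *-cong (const-sign-suc (suc j)) (*-congˡ (*-congʳ (e-suc-∷ j x L₁))) ⟩
    - σ * (q^ m * ((q^ x * e j L₁ + e (suc j) L₁) * Θ m L₂))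
      ≈⟨ *-congˡ (trans (*-congˡ (distribʳ _ _ _)) (distribˡ _ _ _)) ⟩
    - σ * (q^ m * ((q^ x * e j L₁) * Θ m L₂) + q^ m * (e (suc j) L₁ * Θ m L₂))
      ≈⟨ distribˡ _ _ _ ⟩
    - σ * (q^ m * ((q^ x * e j L₁) * Θ m L₂)) + - σ * (q^ m * (e (suc j) L₁ * Θ m L₂))
      ≈⟨ +-cong pull-q^x (*-congʳ (sym (const-sign-suc (suc j)))) ⟩
    - (q^ x * splitTerm j L₁ m L₂) + splitTerm (suc j) L₁ m L₂
      ∎
    where
    σ = const (sign R (suc j))
    pull-q^x : - σ * (q^ m * ((q^ x * e j L₁) * Θ m L₂)) ≈ - (q^ x * splitTerm j L₁ m L₂)
    pull-q^x = begin
      - σ * (q^ m * ((q^ x * e j L₁) * Θ m L₂))   ≈⟨ -‿distribˡ-* _ _ ⟨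
      - (σ * (q^ m * ((q^ x * e j L₁) * Θ m L₂))) ≈⟨ -‿cong (*-congˡ (*-congˡ (*-assoc _ _ _))) ⟩
      - (σ * (q^ m * (q^ x * (e j L₁ * Θ m L₂)))) ≈⟨ -‿cong (*-congˡ (x∙yz≈y∙xz _ _ _)) ⟩
      - (σ * (q^ x * (q^ m * (e j L₁ * Θ m L₂)))) ≈⟨ -‿cong (x∙yz≈y∙xz _ _ _) ⟩
      - (q^ x * splitTerm j L₁ m L₂)              ∎

  Φ≈∑splits : ∀ j L → Φ (suc (suc j)) L ≈ ∑splits (splitTerm j) L
  Φ≈∑splits j       []      = Φ-[] j
  Φ≈∑splits zero    (x ∷ L) = begin
    Φ 2 (x ∷ L)                                            ≈⟨ Φ₂-∷ x L ⟩
    - (q^ x * Θ x L) + Φ 2 L                               ≈⟨ +-congˡ (Φ≈∑splits zero L) ⟩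
    - (q^ x * Θ x L) + ∑splits (splitTerm 0) L             ≈⟨ +-cong (splitTerm-zero-[] x L) (∑splits-cong L (splitTerm-zero-∷ x)) ⟨
    splitTerm 0 [] x L + ∑splits (splitTerm 0 ∘ (x ∷_)) L ∎
  Φ≈∑splits (suc j) (x ∷ L) = begin
    Φ (3 ℕ.+ j) (x ∷ L)
      ≈⟨ Φ-∷ j x L ⟩
    - (q^ x * Φ (2 ℕ.+ j) L) + Φ (3 ℕ.+ j) L
      ≈⟨ +-cong (-‿cong (*-congˡ (Φ≈∑splits j L))) (Φ≈∑splits (suc j) L) ⟩
    - (q^ x * ∑splits (splitTerm j) L) + ∑splits (splitTerm (suc j)) L
      ≈⟨ +-congʳ (trans (∑splits-neg L _) (-‿cong (∑splits-*ˡ L (q^ x) (splitTerm j)))) ⟨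
    ∑splits (λ L₁ m L₂ → - (q^ x * splitTerm j L₁ m L₂)) L + ∑splits (splitTerm (suc j)) L
      ≈⟨ ∑splits-+ L _ _ ⟨
    ∑splits (λ L₁ m L₂ → - (q^ x * splitTerm j L₁ m L₂) + splitTerm (suc j) L₁ m L₂) L
      ≈⟨ ∑splits-cong L (λ L₁ m L₂ → sym (splitTerm-suc-∷ j x L₁ m L₂)) ⟩
    ∑splits (splitTerm (suc j) ∘ (x ∷_)) L
      ≈⟨ trans (+-congʳ (splitTerm-suc-[] j x L)) (+-identityˡ _) ⟨
    splitTerm (suc j) [] x L + ∑splits (splitTerm (suc j) ∘ (x ∷_)) L
      ∎

  ∑splits-interval : ∀ n a h N → ∑splits h (interval a n) N R.≈
                     ∑ n (λ t → h (interval a t) (a ℕ.+ t) (interval (suc (a ℕ.+ t)) (n ∸ suc t)) N)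
  ∑splits-interval zero    a h N = R.reflexive (P.sym (∑-empty _))
  ∑splits-interval (suc n) a h N = R.trans
    (R.+-cong (R.reflexive (P.cong (λ u → h [] u (interval (suc u) n) N) (P.sym (ℕP.+-identityʳ a))))
              (R.trans (∑splits-interval n (suc a) (h ∘ (a ∷_)) N)
                       (∑-cong n (λ t → R.reflexive (P.cong (λ u → h (interval a (suc t)) u (interval (suc u) (n ∸ suc t)) N)
                                                             (P.sym (ℕP.+-suc a t)))))))
    (R.reflexive (P.sym (∑-suc n _)))

  geom-suc : ∀ d → geom R z (suc d) R.≈ R.1# R.+ z R.* geom R z d
  geom-suc d = R.trans (R.reflexive (P.trans (sumR-map-upTo (suc d) (pow R z)) (∑-suc d (pow R z))))
    (R.+-congˡ (R.trans (R.sym (∑-*ˡ d z (pow R z))) (R.*-congˡ (R.reflexive (P.sym (sumR-map-upTo d (pow R z)))))))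

  Θ-∷-self : ∀ m L → Θ m (m ∷ L) ≈ Θ m L
  Θ-∷-self m L = begin
    Θ m (m ∷ L)                                              ≈⟨ Θ-∷ m m L ⟩
    - (const (geom R z (m ∸ m)) * (q^ m * Π L)) + Θ m L      ≡⟨ P.cong (λ d → - (const (geom R z d) * (q^ m * Π L)) + Θ m L) (ℕP.n∸n≡0 m) ⟩
    - (const R.0# * (q^ m * Π L)) + Θ m L                    ≈⟨ +-congʳ (trans (-‿cong (trans (*-congʳ const-0) (zeroˡ _))) -0#≈0#) ⟩
    0# + Θ m L                                               ≈⟨ +-identityˡ _ ⟩
    Θ m L                                                    ∎

  Θ-shift : ∀ m L → All (m <_) L → Θ m L ≈ (Π L - 1#) + const z * Θ (suc m) L
  Θ-shift m []      []          = sym (begin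
    (Π [] - 1#) + const z * Θ (suc m) []   ≈⟨ +-cong (trans (+-congʳ Π-[]) (-‿inverseʳ 1#)) (trans (*-congˡ (Θ-[] (suc m))) (zeroʳ _)) ⟩
    0# + 0#                                ≈⟨ +-identityʳ 0# ⟩
    0#                                     ≈⟨ Θ-[] m ⟨
    Θ m []                                 ∎)
  Θ-shift m (y ∷ L) (m<y ∷ m<L) = begin
    Θ m (y ∷ L)                                                ≈⟨ Θ-∷ m y L ⟩
    - (const (geom R z (y ∸ m)) * Y) + Θ m L                   ≈⟨ +-cong (-‿cong (*-congʳ geom-step)) (Θ-shift m L m<L) ⟩
    - ((1# + z′ * g′) * Y) + ((Π L - 1#) + z′ * Θ (suc m) L)   ≈⟨ +-congʳ split-neg ⟩
    (- Y + z′ * - (g′ * Y)) + ((Π L - 1#) + z′ * Θ (suc m) L)  ≈⟨ interchange _ _ _ _ ⟩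
    (- Y + (Π L - 1#)) + (z′ * - (g′ * Y) + z′ * Θ (suc m) L)  ≈⟨ +-cong (trans (sym (+-assoc _ _ _)) (+-congʳ (sym (Π-∷ y L))))
                                                                        (sym (distribˡ _ _ _)) ⟩
    (Π (y ∷ L) - 1#) + z′ * (- (g′ * Y) + Θ (suc m) L)         ≈⟨ +-congˡ (*-congˡ (Θ-∷ (suc m) y L)) ⟨
    (Π (y ∷ L) - 1#) + z′ * Θ (suc m) (y ∷ L)                  ∎
    where
    Y = q^ y * Π L
    z′ = const z
    g′ = const (geom R z (y ∸ suc m))
    geom-step : const (geom R z (y ∸ m)) ≈ 1# + z′ * g′
    geom-step = begin
      const (geom R z (y ∸ m))                       ≡⟨ P.cong (const ∘ geom R z) (ℕP.+-∸-assoc 1 m<y) ⟩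
      const (geom R z (suc (y ∸ suc m)))             ≈⟨ (λ N → R.*-congʳ (geom-suc (y ∸ suc m))) ⟩
      const (R.1# R.+ z R.* geom R z (y ∸ suc m))    ≈⟨ trans (const-+ _ _) (+-cong const-1 (const-* _ _)) ⟩
      1# + z′ * g′                                   ∎
    split-neg : - ((1# + z′ * g′) * Y) ≈ - Y + z′ * - (g′ * Y)
    split-neg = begin
      - ((1# + z′ * g′) * Y)      ≈⟨ -‿cong (trans (distribʳ _ _ _) (+-cong (*-identityˡ Y) (*-assoc _ _ _))) ⟩
      - (Y + z′ * (g′ * Y))       ≈⟨ ⁻¹-∙-comm _ _ ⟨
      - Y + - (z′ * (g′ * Y))     ≈⟨ +-congˡ (-‿distribʳ-* _ _) ⟩
      - Y + z′ * - (g′ * Y)       ∎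

module Products {c ℓ : Level} (R : CommutativeRing c ℓ) where
  private module R = CommutativeRing R
  open PowerSeries R
  open SymmetricFunctions R
  open CommutativeRing SR hiding (zero)
  open import Algebra.Properties.Ring ring using (-‿distribˡ-*; -0#≈0#)
  open import Relation.Binary.Reasoning.Setoid setoid

  Π-∷-product : ∀ x L → Π (x ∷ L) ≈ (1# - q^ x) * Π L
  Π-∷-product x L = begin
    Π (x ∷ L)                     ≈⟨ Π-∷ x L ⟩
    - (q^ x * Π L) + Π L          ≈⟨ +-comm _ _ ⟩
    Π L + - (q^ x * Π L)          ≈⟨ +-cong (*-identityˡ _) (sym (-‿distribˡ-* _ _)) ⟨
    1# * Π L + - q^ x * Π L       ≈⟨ distribʳ _ _ _ ⟨
    (1# - q^ x) * Π L             ∎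

  prodS≈Π : ∀ L → Defs.prodS R (map (λ x → 1# - q^ x) L) ≈ Π L
  prodS≈Π []      = sym Π-[]
  prodS≈Π (x ∷ L) = trans (*-congˡ (prodS≈Π L)) (sym (Π-∷-product x L))

  pochFin≈Π : ∀ a n → Defs.pochFin R a n ≈ Π (interval a n)
  pochFin≈Π a n = trans (reflexive (P.cong (Defs.prodS R) (P.trans (List.map-∘ (upTo n))
                                     (P.cong (map (λ x → 1# - q^ x)) (map-upTo≡interval a n)))))
                        (prodS≈Π (interval a n))

  prodS-∷ʳ : ∀ fs f → Defs.prodS R (fs ++ f ∷ []) ≈ Defs.prodS R fs * f
  prodS-∷ʳ []       f = trans (*-identityʳ f) (sym (*-identityˡ f))
  prodS-∷ʳ (g ∷ fs) f = trans (*-congˡ (prodS-∷ʳ fs f)) (sym (*-assoc _ _ _))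

  pochFin-suc : ∀ a n → Defs.pochFin R a (suc n) ≈ Defs.pochFin R a n * (1# - q^ (a ℕ.+ n))
  pochFin-suc a n = begin
    Defs.prodS R (map factor (upTo (suc n)))         ≡⟨ P.cong (Defs.prodS R ∘ map factor) (List.upTo-∷ʳ n) ⟨
    Defs.prodS R (map factor (upTo n ++ n ∷ []))     ≡⟨ P.cong (Defs.prodS R) (List.map-++ factor (upTo n) (n ∷ [])) ⟩
    Defs.prodS R (map factor (upTo n) ++ factor n ∷ []) ≈⟨ prodS-∷ʳ (map factor (upTo n)) (factor n) ⟩
    Defs.prodS R (map factor (upTo n)) * factor n    ∎
    where
    factor : ℕ → Ser
    factor i = 1# - q^ (a ℕ.+ i)

  qfac-suc : ∀ n → Defs.qfac R (suc n) ≈ Defs.qfac R n * (1# - q^ (suc n))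
  qfac-suc = pochFin-suc 1

  prodS-constant-term : ∀ (f : ℕ → Ser) xs → (∀ x → f x 0 R.≈ R.1#) → Defs.prodS R (map f xs) 0 R.≈ R.1#
  prodS-constant-term f []       f₀≈1 = R.refl
  prodS-constant-term f (x ∷ xs) f₀≈1 = R.trans (⊛-constant-term (f x) (Defs.prodS R (map f xs)))
    (R.trans (R.*-cong (f₀≈1 x) (prodS-constant-term f xs f₀≈1)) (R.*-identityˡ R.1#))

  pochFin-constant-term : ∀ a n → Defs.pochFin R (suc a) n 0 R.≈ R.1#
  pochFin-constant-term a n = prodS-constant-term _ (upTo n) (λ _ → R.trans (R.+-congˡ (-0#≈0# 0)) (R.+-identityʳ R.1#))

  Π-∷-cong-≈[] : ∀ {M L L′} x → Π L ≈[ M ] Π L′ → Π (x ∷ L) ≈[ M ] Π (x ∷ L′)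
  Π-∷-cong-≈[] x L≈L′ = ≈[]-trans (≋⇒≈[] (Π-∷ x _)) (≈[]-trans
    (⊕-cong-≈[] (λ N N≤M → R.-‿cong (⊛-cong-≈[] ≈[]-refl L≈L′ N N≤M)) L≈L′) (≋⇒≈[] (sym (Π-∷ x _))))

  Π-∷-high : ∀ {M} x L → M < x → Π (x ∷ L) ≈[ M ] Π L
  Π-∷-high x L M<x N N≤M = R.trans (Π-∷ x L N)
    (R.trans (R.+-congʳ (R.trans (R.-‿cong (qmon⊛-below x (Π L) N (ℕP.≤-<-trans N≤M M<x))) (-0#≈0# N))) (R.+-identityˡ _))

  Π-interval-high : ∀ {M} a n → M < a → Π (interval a n) ≈[ M ] 1#
  Π-interval-high a zero    M<a = ≋⇒≈[] Π-[]
  Π-interval-high a (suc n) M<a =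
    ≈[]-trans (Π-∷-high a (interval (suc a) n) M<a) (Π-interval-high (suc a) n (ℕP.m<n⇒m<1+n M<a))

  -- factors 1 - q^x with x > M do not affect the coefficients up to q^M
  Π-interval-stable : ∀ {M} a n n′ → M < a ℕ.+ n → M < a ℕ.+ n′ → Π (interval a n) ≈[ M ] Π (interval a n′)
  Π-interval-stable {M} a zero    n′      M<a _ =
    ≈[]-trans (≋⇒≈[] Π-[]) (≈[]-sym (Π-interval-high a n′ (P.subst (M <_) (ℕP.+-identityʳ a) M<a)))
  Π-interval-stable {M} a (suc n) zero    _ M<a =
    ≈[]-trans (Π-interval-high a (suc n) (P.subst (M <_) (ℕP.+-identityʳ a) M<a)) (≋⇒≈[] (sym Π-[]))
  Π-interval-stable {M} a (suc n) (suc n′) M<a+1+n M<a+1+n′ = Π-∷-cong-≈[] a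
    (Π-interval-stable (suc a) n n′ (P.subst (M <_) (ℕP.+-suc a n) M<a+1+n) (P.subst (M <_) (ℕP.+-suc a n′) M<a+1+n′))

  pochInf≈[]Π : ∀ a n M → M < a ℕ.+ n → Defs.pochInf R a ≈[ M ] Π (interval a n)
  pochInf≈[]Π a n M M<a+n N N≤M = R.trans (pochFin≈Π a (suc N) N)
    (Π-interval-stable a (suc N) n (ℕP.m≤n+m (suc N) a) (ℕP.≤-<-trans N≤M M<a+n) N ℕP.≤-refl)

module GaussianBinomial {c ℓ : Level} (R : CommutativeRing c ℓ) where
  private module R = CommutativeRing R
  open PowerSeries R using (SR; qmon-+; ⊛-constant-term; ⊛-invS)
  open SymmetricFunctions R
  open Products R
  open CommutativeRing SR hiding (zero)
  open import Algebra.Properties.Ring ring using (-‿distribʳ-*)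
  open import Algebra.Properties.CommutativeSemigroup *-commutativeSemigroup using (x∙yz≈y∙xz; xy∙z≈xz∙y)
  open import Relation.Binary.Reasoning.Setoid setoid

  triangular : ℕ → ℕ
  triangular zero    = 0
  triangular (suc r) = triangular r ℕ.+ suc r

  triangular≡ : ∀ r → (suc r ℕ.* r) ℕ./ 2 ≡ triangular r
  triangular≡ r = P.trans (P.cong (ℕ._/ 2) (P.sym (double r))) (Data.Nat.DivMod.m*n/n≡m (triangular r) 2)
    where
    double : ∀ r → triangular r ℕ.* 2 ≡ suc r ℕ.* r
    double zero    = P.refl
    double (suc r) = P.trans (ℕP.*-distribʳ-+ 2 (triangular r) (suc r))
                       (P.trans (P.cong (ℕ._+ suc r ℕ.* 2) (double r)) (factor r))
      where
      open Data.Nat.Tactic.RingSolver using (solve-∀)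
      factor : ∀ r → suc r ℕ.* r ℕ.+ suc r ℕ.* 2 ≡ suc (suc r) ℕ.* suc r
      factor = solve-∀

  e-vanishes : ∀ r L → length L < r → e r L ≈ 0#
  e-vanishes (suc r) []      _          = e-suc-[] r
  e-vanishes (suc r) (x ∷ L) (s≤s |L|<r) = begin
    e (suc r) (x ∷ L)              ≈⟨ e-suc-∷ r x L ⟩
    q^ x * e r L + e (suc r) L     ≈⟨ +-cong (*-congˡ (e-vanishes r L |L|<r)) (e-vanishes (suc r) L (ℕP.m<n⇒m<1+n |L|<r)) ⟩
    q^ x * 0# + 0#                 ≈⟨ trans (+-identityʳ _) (zeroʳ _) ⟩
    0#                             ∎

  e-interval-suc : ∀ n a r → e r (interval (suc a) n) ≈ q^ r * e r (interval a n)
  e-interval-suc n       a zero    = trans (e-zero _) (sym (trans (*-congˡ (e-zero _)) (*-identityʳ _)))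
  e-interval-suc zero    a (suc r) = trans (e-suc-[] r) (sym (trans (*-congˡ (e-suc-[] r)) (zeroʳ _)))
  e-interval-suc (suc n) a (suc r) = begin
    e (suc r) (suc a ∷ I₂)
      ≈⟨ e-suc-∷ r (suc a) I₂ ⟩
    q^ (suc a) * e r I₂ + e (suc r) I₂
      ≈⟨ +-cong (*-congˡ (e-interval-suc n (suc a) r)) (e-interval-suc n (suc a) (suc r)) ⟩
    q^ (suc a) * (q^ r * e r I₁) + q^ (suc r) * e (suc r) I₁
      ≈⟨ +-congʳ (x∙yz≈y∙xz _ _ _) ⟩
    q^ r * (q^ (suc a) * e r I₁) + q^ (suc r) * e (suc r) I₁
      ≈⟨ +-congʳ (trans (sym (*-assoc _ _ _)) (*-congʳ q^r*q^1+a≈q^1+r*q^a)) ⟩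
    q^ (suc r) * q^ a * e r I₁ + q^ (suc r) * e (suc r) I₁
      ≈⟨ trans (+-congʳ (*-assoc _ _ _)) (sym (distribˡ _ _ _)) ⟩
    q^ (suc r) * (q^ a * e r I₁ + e (suc r) I₁)
      ≈⟨ *-congˡ (e-suc-∷ r a I₁) ⟨
    q^ (suc r) * e (suc r) (a ∷ I₁)
      ∎
    where
    I₁ = interval (suc a) n
    I₂ = interval (suc (suc a)) n
    q^r*q^1+a≈q^1+r*q^a : q^ r * q^ (suc a) ≈ q^ (suc r) * q^ a
    q^r*q^1+a≈q^1+r*q^a = trans (qmon-+ r (suc a))
      (trans (reflexive (P.cong q^ (ℕP.+-suc r a))) (sym (qmon-+ (suc r) a)))

  e-pascal : ∀ n r → e (suc r) (interval 1 (suc n)) ≈ q^ (suc r) * (e r (interval 1 n) + e (suc r) (interval 1 n))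
  e-pascal n r = begin
    e (suc r) (1 ∷ interval 2 n)                                        ≈⟨ e-suc-∷ r 1 (interval 2 n) ⟩
    q^ 1 * e r (interval 2 n) + e (suc r) (interval 2 n)                ≈⟨ +-cong (*-congˡ (e-interval-suc n 1 r)) (e-interval-suc n 1 (suc r)) ⟩
    q^ 1 * (q^ r * e r (interval 1 n)) + q^ (suc r) * e (suc r) (interval 1 n)
                                                                        ≈⟨ +-congʳ (trans (sym (*-assoc _ _ _)) (*-congʳ (qmon-+ 1 r))) ⟩
    q^ (suc r) * e r (interval 1 n) + q^ (suc r) * e (suc r) (interval 1 n) ≈⟨ distribˡ _ _ _ ⟨
    q^ (suc r) * (e r (interval 1 n) + e (suc r) (interval 1 n))         ∎

  X[1-p]+pX[1-s]≈X[1-ps] : ∀ X p s → X * (1# - p) + p * X * (1# - s) ≈ X * (1# - p * s)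
  X[1-p]+pX[1-s]≈X[1-ps] X p s = begin
    X * (1# - p) + p * X * (1# - s)                ≈⟨ +-cong (distribˡ _ _ _) (distribˡ _ _ _) ⟩
    (X * 1# + X * - p) + (p * X * 1# + p * X * - s) ≈⟨ +-cong (+-cong (*-identityʳ X) (sym (-‿distribʳ-* _ _)))
                                                               (+-cong (*-identityʳ _) (sym (-‿distribʳ-* _ _))) ⟩
    (X - X * p) + (p * X - p * X * s)              ≈⟨ +-congʳ (+-congˡ (-‿cong (*-comm X p))) ⟩
    (X - p * X) + (p * X - p * X * s)              ≈⟨ +-assoc _ _ _ ⟩
    X + (- (p * X) + (p * X - p * X * s))          ≈⟨ +-congˡ (sym (+-assoc _ _ _)) ⟩
    X + ((- (p * X) + p * X) - p * X * s)          ≈⟨ +-congˡ (+-congʳ (-‿inverseˡ _)) ⟩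
    X + (0# - p * X * s)                           ≈⟨ +-congˡ (+-identityˡ _) ⟩
    X - p * X * s                                  ≈⟨ +-congˡ (-‿cong (trans (*-congʳ (*-comm p X)) (*-assoc X p s))) ⟩
    X - X * (p * s)                                ≈⟨ +-cong (*-identityʳ X) (sym (-‿distribʳ-* _ _)) ⟨
    X * 1# + X * - (p * s)                         ≈⟨ distribˡ _ _ _ ⟨
    X * (1# - p * s)                               ∎

  q^-triangular-suc : ∀ r → q^ (triangular (suc r)) ≈ q^ (suc r) * q^ (triangular r)
  q^-triangular-suc r = trans (reflexive (P.cong q^ (ℕP.+-comm (triangular r) (suc r)))) (sym (qmon-+ (suc r) (triangular r)))

  -- the (n, r + 1) instance of e-interval-qfac below, with (q;q)_(n-r) in place of (q;q)_(n-r-1)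
  e-interval-qfac-suc : ∀ n r → r ≤ n →
    (r < n → e (suc r) (interval 1 n) * (Defs.qfac R (suc r) * Defs.qfac R (n ∸ suc r)) ≈ q^ (triangular (suc r)) * Defs.qfac R n) →
    e (suc r) (interval 1 n) * (Defs.qfac R (suc r) * Defs.qfac R (n ∸ r)) ≈ q^ (triangular (suc r)) * Defs.qfac R n * (1# - q^ (n ∸ r))
  e-interval-qfac-suc n r r≤n IH with ℕP.m≤n⇒m<n∨m≡n r≤n
  ... | inj₂ P.refl = begin
    e (suc r) (interval 1 r) * W          ≈⟨ trans (*-congʳ (e-vanishes (suc r) (interval 1 r) |I|<1+r)) (zeroˡ W) ⟩
    0#                                    ≈⟨ zeroʳ _ ⟨
    X * 0#                                ≈⟨ *-congˡ (trans (+-congˡ (-‿cong (reflexive (P.cong q^ (ℕP.n∸n≡0 r))))) (-‿inverseʳ 1#)) ⟨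
    X * (1# - q^ (r ∸ r))                 ∎
    where
    W = Defs.qfac R (suc r) * Defs.qfac R (r ∸ r)
    X = q^ (triangular (suc r)) * Defs.qfac R r
    |I|<1+r = ℕP.≤-reflexive (P.cong suc (length-interval 1 r))
  ... | inj₁ r<n = begin
    B * (Defs.qfac R (suc r) * Defs.qfac R (n ∸ r))                  ≡⟨ P.cong (λ t → B * (Defs.qfac R (suc r) * Defs.qfac R t)) n∸r≡1+m ⟩
    B * (Defs.qfac R (suc r) * Defs.qfac R (suc m))                  ≈⟨ *-congˡ (*-congˡ (qfac-suc m)) ⟩
    B * (Defs.qfac R (suc r) * (Defs.qfac R m * (1# - q^ (suc m))))  ≈⟨ trans (*-congˡ (sym (*-assoc _ _ _))) (sym (*-assoc _ _ _)) ⟩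
    B * (Defs.qfac R (suc r) * Defs.qfac R m) * (1# - q^ (suc m))    ≈⟨ *-cong (IH r<n) (reflexive (P.cong (λ t → 1# - q^ t) (P.sym n∸r≡1+m))) ⟩
    q^ (triangular (suc r)) * Defs.qfac R n * (1# - q^ (n ∸ r))      ∎
    where
    B = e (suc r) (interval 1 n)
    m = n ∸ suc r
    n∸r≡1+m : n ∸ r ≡ suc m
    n∸r≡1+m = ℕP.+-∸-assoc 1 r<n

  e-interval-qfac : ∀ n r → r ≤ n →
                    e r (interval 1 n) * (Defs.qfac R r * Defs.qfac R (n ∸ r)) ≈ q^ (triangular r) * Defs.qfac R n
  e-interval-qfac n       zero    _         = trans (*-congʳ (e-zero _)) (*-identityˡ _)
  e-interval-qfac (suc n) (suc r) (s≤s r≤n) = begin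
    e (suc r) (interval 1 (suc n)) * W        ≈⟨ *-congʳ (e-pascal n r) ⟩
    p * (A + B) * W                           ≈⟨ trans (*-assoc _ _ _) (*-congˡ (distribʳ _ _ _)) ⟩
    p * (A * W + B * W)                       ≈⟨ *-congˡ (+-cong A-term B-term) ⟩
    p * (X * (1# - p) + p * X * (1# - s))     ≈⟨ *-congˡ (X[1-p]+pX[1-s]≈X[1-ps] X p s) ⟩
    p * (X * (1# - p * s))                    ≈⟨ *-congˡ (*-congˡ (+-congˡ (-‿cong p*s≈q^[1+n]))) ⟩
    p * (X * (1# - q^ (suc n)))               ≈⟨ trans (*-congˡ (*-assoc _ _ _)) (sym (*-assoc _ _ _)) ⟩
    p * q^ (triangular r) * (Defs.qfac R n * (1# - q^ (suc n)))
                                              ≈⟨ *-cong (sym (q^-triangular-suc r)) (sym (qfac-suc n)) ⟩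
    q^ (triangular (suc r)) * Defs.qfac R (suc n) ∎
    where
    p = q^ (suc r)
    s = q^ (n ∸ r)
    A = e r (interval 1 n)
    B = e (suc r) (interval 1 n)
    W = Defs.qfac R (suc r) * Defs.qfac R (n ∸ r)
    X = q^ (triangular r) * Defs.qfac R n

    p*s≈q^[1+n] : p * s ≈ q^ (suc n)
    p*s≈q^[1+n] = trans (qmon-+ (suc r) (n ∸ r)) (reflexive (P.cong (q^ ∘ suc) (ℕP.m+[n∸m]≡n r≤n)))

    A-term : A * W ≈ X * (1# - p)
    A-term = begin
      A * (Defs.qfac R (suc r) * Defs.qfac R (n ∸ r))              ≈⟨ *-congˡ (*-congʳ (qfac-suc r)) ⟩
      A * (Defs.qfac R r * (1# - p) * Defs.qfac R (n ∸ r))         ≈⟨ trans (*-congˡ (xy∙z≈xz∙y _ _ _)) (sym (*-assoc _ _ _)) ⟩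
      A * (Defs.qfac R r * Defs.qfac R (n ∸ r)) * (1# - p)         ≈⟨ *-congʳ (e-interval-qfac n r r≤n) ⟩
      X * (1# - p)                                                 ∎

    B-term : B * W ≈ p * X * (1# - s)
    B-term = trans (e-interval-qfac-suc n r r≤n (e-interval-qfac n (suc r)))
                   (*-congʳ (trans (*-congʳ (q^-triangular-suc r)) (*-assoc _ _ _)))

  qbinom-≤ : ∀ {n r} → r ≤ n → Defs.qbinom R n r ≈ Defs.qfac R n * Defs.invS R (Defs.qfac R r * Defs.qfac R (n ∸ r))
  qbinom-≤ {n} {r} r≤n N = R.reflexive (P.cong (λ b → if b then binom N else R.0#) (Equivalence.to T-≡ (ℕP.≤⇒≤ᵇ r≤n)))
    where binom = Defs.qfac R n * Defs.invS R (Defs.qfac R r * Defs.qfac R (n ∸ r))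

  qbinom-> : ∀ {n r} → n < r → Defs.qbinom R n r ≈ 0#
  qbinom-> {n} {r} n<r N = R.reflexive (P.cong (λ b → if b then binom N else R.0#) r≤ᵇn≡false)
    where
    binom = Defs.qfac R n * Defs.invS R (Defs.qfac R r * Defs.qfac R (n ∸ r))
    r≤ᵇn≡false : (r ℕ.≤ᵇ n) ≡ false
    r≤ᵇn≡false with r ℕ.≤ᵇ n | ℕP.≤ᵇ-reflects-≤ r n
    ... | false | _        = P.refl
    ... | true  | ofʸ r≤n = ⊥-elim (ℕP.<⇒≱ n<r r≤n)

  q^-triangular*qbinom : ∀ n r → q^ (triangular r) * Defs.qbinom R n r ≈ e r (interval 1 n)
  q^-triangular*qbinom n r with r ℕP.≤? n
  ... | yes r≤n = begin
    q^ (triangular r) * Defs.qbinom R n r                            ≈⟨ *-congˡ (qbinom-≤ r≤n) ⟩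
    q^ (triangular r) * (Defs.qfac R n * Defs.invS R P)              ≈⟨ *-assoc _ _ _ ⟨
    q^ (triangular r) * Defs.qfac R n * Defs.invS R P                ≈⟨ *-congʳ (e-interval-qfac n r r≤n) ⟨
    e r (interval 1 n) * P * Defs.invS R P                           ≈⟨ *-assoc _ _ _ ⟩
    e r (interval 1 n) * (P * Defs.invS R P)                         ≈⟨ *-congˡ (⊛-invS P P₀≈1) ⟩
    e r (interval 1 n) * 1#                                          ≈⟨ *-identityʳ _ ⟩
    e r (interval 1 n)                                               ∎
    where
    P = Defs.qfac R r * Defs.qfac R (n ∸ r)
    P₀≈1 : P 0 R.≈ R.1#
    P₀≈1 = R.trans (⊛-constant-term (Defs.qfac R r) (Defs.qfac R (n ∸ r)))
             (R.trans (R.*-cong (pochFin-constant-term 0 r) (pochFin-constant-term 0 (n ∸ r))) (R.*-identityˡ R.1#))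
  ... | no r≰n = begin
    q^ (triangular r) * Defs.qbinom R n r  ≈⟨ trans (*-congˡ (qbinom-> (ℕP.≰⇒> r≰n))) (zeroʳ _) ⟩
    0#                                     ≈⟨ e-vanishes r (interval 1 n) (P.subst (_< r) (P.sym (length-interval 1 n)) (ℕP.≰⇒> r≰n)) ⟨
    e r (interval 1 n)                     ∎

module InnerSum {c ℓ : Level} (R : CommutativeRing c ℓ) (z w : CommutativeRing.Carrier R)
                (z*w≈1 : CommutativeRing._≈_ R (CommutativeRing._*_ R z w) (CommutativeRing.1# R)) where
  private module R = CommutativeRing R
  open PowerSeries R
  open SymmetricFunctions R
  open Splitting R z
  open Products R
  open CommutativeRing SR hiding (zero)
  open import Algebra.Properties.CommutativeSemigroup R.*-commutativeSemigroup using (interchange; x∙yz≈xy∙z)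

  innerTerm : ℕ → Ser
  innerTerm n = scale R (pow R z n) (Defs.pochInf R n - 1#)

  innerTerm-vanishes : ∀ n N → N < n → innerTerm n N R.≈ R.0#
  innerTerm-vanishes n N N<n = R.trans (R.*-congˡ (R.+-congʳ pochInf≈1)) (R.trans (R.*-congˡ (R.-‿inverseʳ (1# N))) (R.zeroʳ _))
    where
    pochInf≈1 : Defs.pochInf R n N R.≈ 1# N
    pochInf≈1 = R.trans (pochInf≈[]Π n 0 N (P.subst (N <_) (P.sym (ℕP.+-identityʳ n)) N<n) N ℕP.≤-refl) (Π-[] N)

  inner-unfold : ∀ m → Defs.inner R z m ≈ innerTerm (suc m) + Defs.inner R z (suc m)
  inner-unfold m N = sumFrom-unfold (suc m) (λ n → innerTerm n) N (innerTerm-vanishes (suc m) N)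

  pow-w*pow-z : ∀ n → pow R w n R.* pow R z n R.≈ R.1#
  pow-w*pow-z zero    = R.*-identityˡ R.1#
  pow-w*pow-z (suc n) = R.trans (interchange w (pow R w n) z (pow R z n))
    (R.trans (R.*-cong (R.trans (R.*-comm w z) z*w≈1) (pow-w*pow-z n)) (R.*-identityˡ R.1#))

  -- Σ_{n > m} z^{n-m-1} ((q^n; q)_∞ - 1), as w = z⁻¹
  I : ℕ → Ser
  I m = scale R (pow R w (suc m)) (Defs.inner R z m)

  I-unfold : ∀ m → I m ≈ (Defs.pochInf R (suc m) - 1#) + const z * I (suc m)
  I-unfold m N = R.trans (R.*-congˡ (inner-unfold m N)) (R.trans (R.distribˡ _ _ _) (R.+-cong cancel reindex))
    where
    cancel : pow R w (suc m) R.* innerTerm (suc m) N R.≈ (Defs.pochInf R (suc m) - 1#) N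
    cancel = R.trans (x∙yz≈xy∙z _ _ _) (R.trans (R.*-congʳ (pow-w*pow-z (suc m))) (R.*-identityˡ _))
    reindex : pow R w (suc m) R.* Defs.inner R z (suc m) N R.≈ (const z * I (suc m)) N
    reindex = R.trans (R.*-congʳ (R.sym (R.trans (x∙yz≈xy∙z z w _) (R.trans (R.*-congʳ z*w≈1) (R.*-identityˡ _)))))
              (R.trans (R.*-assoc _ _ _) (scale≋const⊛ z (I (suc m)) N))

  I≈[]Θ : ∀ k m → I m ≈[ m ℕ.+ k ] Θ m (interval (suc m) k)
  I≈[]Θ zero    m N N≤m+0 = R.trans (R.*-congˡ (sumFrom-vanishes (suc m) innerTerm N N<1+m))
                              (R.trans (R.zeroʳ _) (R.sym (Θ-[] m N)))
    where N<1+m = s≤s (P.subst (N ≤_) (ℕP.+-identityʳ m) N≤m+0)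
  I≈[]Θ (suc k) m = ≈[]-trans (≋⇒≈[] (I-unfold m)) (≈[]-trans
    (⊕-cong-≈[] (⊕-cong-≈[] (pochInf≈[]Π (suc m) (suc k) (m ℕ.+ suc k) ℕP.≤-refl) ≈[]-refl)
                (⊛-cong-≈[] ≈[]-refl (P.subst (λ M → I (suc m) ≈[ M ] Θ (suc m) J) (P.sym (ℕP.+-suc m k)) (I≈[]Θ k (suc m)))))
    (≋⇒≈[] (sym Θ-step)))
    where
    J = interval (suc (suc m)) k
    Θ-step : Θ m (suc m ∷ J) ≈ (Π (suc m ∷ J) - 1#) + const z * Θ (suc m) J
    Θ-step = trans (Θ-shift m (suc m ∷ J) (All-interval (suc m) (suc k))) (+-congˡ (*-congˡ (Θ-∷-self (suc m) J)))

  I≈[]Θ-interval : ∀ M m → I m ≈[ M ] Θ m (interval (suc m) (M ∸ m))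
  I≈[]Θ-interval M m = ≈[]-weaken (ℕP.m≤n+m∸n M m) (I≈[]Θ (M ∸ m) m)

module TwoSides {c ℓ : Level} (R : CommutativeRing c ℓ) (z w : CommutativeRing.Carrier R)
                (z*w≈1 : CommutativeRing._≈_ R (CommutativeRing._*_ R z w) (CommutativeRing.1# R)) (j : ℕ) where
  private module R = CommutativeRing R
  open FiniteSum R
  open PowerSeries R
  open SubsetSums R
  open SymmetricFunctions R
  open Splitting R z
  open GaussianBinomial R
  open InnerSum R z w z*w≈1
  open CommutativeRing SR hiding (zero)
  open import Algebra.Solver.CommutativeMonoid *-commutativeMonoid using (solve; _⊜_) renaming (_⊕_ to _·_)

  k : ℕ
  k = suc (suc j)

  splitSum : ℕ → R.Carrier
  splitSum N = ∑ N (λ t → splitTerm j (interval 1 t) (suc t) (interval (suc (suc t)) (N ∸ suc t)) N)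

  lhs≈Φ : ∀ N → lhs R k z N R.≈ Φ k (interval 1 N) N
  lhs≈Φ zero    = R.sym (Φ-[] j 0)
  lhs≈Φ (suc n) = R.trans (sumR-map-filter (λ π → k ≤? length π) (lhsTerm R k z) (D (suc n)))
    (R.trans (sumR-map-filter (λ π → sum π ℕ.≟ suc n) _ (sublists (map suc (upTo (suc n)))))
      (R.reflexive (P.trans (P.cong (λ L → sumR R (map (λ S → if sum S ≡ᵇ suc n then weight S else R.0#) (sublists L)))
                                     (map-upTo≡interval 1 (suc n)))
                            (P.sym (subsetSum-def (interval 1 (suc n)) weight (suc n))))))
    where
    weight : List ℕ → R.Carrier
    weight S = if does (k ≤? length S) then lhsTerm R k z S else R.0#

  lhs≈splitSum : ∀ N → lhs R k z N R.≈ splitSum N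
  lhs≈splitSum N = R.trans (lhs≈Φ N) (R.trans (Φ≈∑splits j (interval 1 N) N) (∑splits-interval N 1 (splitTerm j) N))

  summand : ℕ → Ser
  summand m = scale R (pow R w m) (q^ m * (Defs.qbinom R (m ∸ 1) j * Defs.inner R z m))

  summand-low-order : ∀ m N → N < m → summand m N R.≈ R.0#
  summand-low-order m N N<m = R.trans (R.*-congˡ (qmon⊛-below m (Defs.qbinom R (m ∸ 1) j * Defs.inner R z m) N N<m)) (R.zeroʳ _)

  summand-vanishes-below-k : ∀ i → i < j → ∀ N → summand (suc i) N R.≈ R.0#
  summand-vanishes-below-k i i<j N = R.trans (R.*-congˡ (R.trans (*-congˡ {q^ (suc i)} qbinom*inner≈0 N) (zeroʳ (q^ (suc i)) N))) (R.zeroʳ _)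
    where
    qbinom*inner≈0 : Defs.qbinom R i j * Defs.inner R z (suc i) ≈ 0#
    qbinom*inner≈0 = trans (*-congʳ (qbinom-> i<j)) (zeroˡ _)

  T : ℕ
  T = (suc j ℕ.* j) ℕ./ 2

  summand≈splitTerm : ∀ t N → (const (sign R (suc j) R.* w) * (q^ T * summand (suc t))) N R.≈
                                splitTerm j (interval 1 t) (suc t) (interval (suc (suc t)) (N ∸ suc t)) N
  summand≈splitTerm t N = ≈[]-trans (≋⇒≈[] regroup) I≈Θ N ℕP.≤-refl
    where
    σ = const (sign R (suc j))
    W = const (pow R w (suc t))
    B = Defs.qbinom R t j
    In = Defs.inner R z (suc t)
    regroup : const (sign R (suc j) R.* w) * (q^ T * summand (suc t)) ≈ σ * (q^ (suc t) * (e j (interval 1 t) * I (suc t)))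
    regroup = begin
      const (sign R (suc j) R.* w) * (q^ T * summand (suc t))
        ≈⟨ *-cong (const-* _ w) (*-cong (reflexive (P.cong q^ (triangular≡ j))) (scale≋const⊛ _ _)) ⟩
      (σ * const w) * (q^ (triangular j) * (W * (q^ (suc t) * (B * In))))
        ≈⟨ solve 7 (λ a b c d e f g → (a · b) · (c · (d · (e · (f · g))))
                                    ⊜ a · (e · ((c · f) · ((b · d) · g)))) refl _ _ _ _ _ _ _ ⟩
      σ * (q^ (suc t) * ((q^ (triangular j) * B) * ((const w * W) * In)))
        ≈⟨ *-congˡ (*-congˡ (*-cong (q^-triangular*qbinom t j) (trans (*-congʳ (sym (const-* w _))) (sym (scale≋const⊛ _ In))))) ⟩
      σ * (q^ (suc t) * (e j (interval 1 t) * I (suc t)))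
        ∎
      where open import Relation.Binary.Reasoning.Setoid setoid
    I≈Θ : σ * (q^ (suc t) * (e j (interval 1 t) * I (suc t))) ≈[ N ] splitTerm j (interval 1 t) (suc t) (interval (suc (suc t)) (N ∸ suc t))
    I≈Θ = ⊛-cong-≈[] ≈[]-refl (⊛-cong-≈[] ≈[]-refl (⊛-cong-≈[] ≈[]-refl (I≈[]Θ-interval N (suc t))))

  rhs≈splitSum : ∀ N → rhs R k z w N R.≈ splitSum N
  rhs≈splitSum N = begin
    σw R.* (q^ T * Defs.sumFrom R (suc j) summand) N        ≈⟨ R.*-congˡ (⊛-cong-≈[] ≈[]-refl tail N ℕP.≤-refl) ⟩
    σw R.* (q^ T * ∑S N (summand ∘ suc)) N                  ≈⟨ R.*-congˡ (⊛-∑S N (q^ T) (summand ∘ suc) N) ⟩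
    σw R.* ∑ N (λ t → (q^ T * summand (suc t)) N)           ≈⟨ ∑-*ˡ N σw _ ⟩
    ∑ N (λ t → σw R.* (q^ T * summand (suc t)) N)           ≈⟨ ∑-cong N (λ t → R.trans (scale≋const⊛ σw (q^ T * summand (suc t)) N)
                                                                                                  (summand≈splitTerm t N)) ⟩
    splitSum N                                              ∎
    where
    open import Relation.Binary.Reasoning.Setoid R.setoid
    σw = sign R (suc j) R.* w
    tail : Defs.sumFrom R (suc j) summand ≈[ N ] ∑S N (summand ∘ suc)
    tail = ≈[]-trans (λ N′ _ → sumFrom-skip 1 j summand summand-vanishes-below-k N′) (sumFrom-1≈[]∑S summand summand-low-order N)

theorem4p1 : ∀ {c ℓ} (R : CommutativeRing c ℓ) (k : ℕ) → 2 ≤ k →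
             (z w : CommutativeRing.Carrier R) →
             CommutativeRing._≈_ R (CommutativeRing._*_ R z w) (CommutativeRing.1# R) →
             (N : ℕ) → CommutativeRing._≈_ R (lhs R k z N) (rhs R k z w N)
theorem4p1 R (suc (suc j)) (s≤s (s≤s _)) z w z*w≈1 N =
  CommutativeRing.trans R (lhs≈splitSum N) (CommutativeRing.sym R (rhs≈splitSum N))
  where open TwoSides R z w z*w≈1 j
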